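{- Let $P$ be a finite poset with $|P|\ge2$, connected Hasse diagram, and a maximum element $\hat1$. Suppose that (1) $M_P$ is acyclic and (2) $P$ satisfies the cc condition. Let $\sim$ be the tree relation on $P$. Then $U_P$ is Gorenstein if and only if $U_{P/{\sim}}$ is Gorenstein.
   Context: For a poset $Q$ (identified with $[m]$), $U_Q$ is the affine toric variety of the braid cone $\sigma_Q=\{x\in\mathbb{R}^m/\mathbb{R}(1,\dots,1): x_i\le x_j\text{ whenever } i<_Qj\}$ over the lattice $\mathbb{Z}^m/\mathbb{Z}(1,\dots,1)$; it is Gorenstein if some dual lattice vector pairs to $1$ with every ray generator of $\sigma_Q$. $M_P=\{x\in P:\text{every } y\text{ covered by } x\text{ is minimal}\}$, an induced subposet; acyclic means its undirected Hasse diagram has no cycle. For $S\subseteq P$, $cc(S)$ is the number of connected components of the subgraph of the undirected Hasse diagram induced on $S$. A connected downset is a nonempty downset $C$ with $cc(C)=1$; it satisfies the cc condition if the number of connected components of $M_P$ meeting $C$ equals $cc(C\cap M_P)$, and $P$ satisfies the cc condition if every connected downset does. The tree relation (when $M_P$ is acyclic) is the equivalence relation with $x\sim y$ iff $x=y$ or $x,y$ lie in the same connected component of $M_P$. The quotient $P/{\sim}$ is the set of equivalence classes with $X\le Y$ iff $x\le y$ for some $x\in X$, $y\in Y$; this is a partial order. -}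

module Defs where

open import Level using (0ℓ)
open import Data.Bool using (Bool; T)
open import Data.Nat as ℕ using (ℕ; zero; suc)
open import Data.Integer as ℤ using (ℤ; +_; 0ℤ; 1ℤ)
open import Data.Fin using (Fin; zero; suc; inject₁; fromℕ)
open import Data.Fin.Subset using (Subset; _∈_)
open import Data.Product using (Σ; ∃; _×_; _,_)
open import Data.Sum using (_⊎_)
open import Data.Empty using (⊥)
open import Data.Unit using (⊤)
open import Relation.Nullary using (¬_)
open import Relation.Binary.PropositionalEquality using (_≡_; _≢_)
open import Relation.Binary.Construct.Closure.ReflexiveTransitive using (Star)
open import Function.Bundles using (_⇔_)

record FinPoset (n : ℕ) : Set where
  field
    le      : Fin n → Fin n → Bool
    refl    : ∀ x → T (le x x)
    antisym : ∀ x y → T (le x y) → T (le y x) → x ≡ y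
    trans   : ∀ x y z → T (le x y) → T (le y z) → T (le x z)

module Graph {n : ℕ} (adj : Fin n → Fin n → Set) where

  AdjIn : (Fin n → Set) → Fin n → Fin n → Set
  AdjIn S x y = S x × S y × adj x y

  ReachIn : (Fin n → Set) → Fin n → Fin n → Set
  ReachIn S = Star (AdjIn S)

  -- HasCC S k : the induced subgraph on S has exactly k connected
  -- components, witnessed by a surjective labelling of S by Fin k whose
  -- fibres are exactly the components.
  HasCC : (Fin n → Set) → ℕ → Set
  HasCC S k =
    Σ ((x : Fin n) → S x → Fin k) λ f →
      (∀ x y (px : S x) (py : S y) → (f x px ≡ f y py) ⇔ ReachIn S x y)
      × (∀ (c : Fin k) → ∃ λ x → Σ (S x) λ px → f x px ≡ c)

  record CycleIn (S : Fin n → Set) : Set where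
    field
      j        : ℕ
      vtx      : Fin (3 ℕ.+ j) → Fin n
      inS      : ∀ i → S (vtx i)
      distinct : ∀ i i′ → vtx i ≡ vtx i′ → i ≡ i′
      step     : ∀ (i : Fin (2 ℕ.+ j)) → adj (vtx (inject₁ i)) (vtx (suc i))
      close    : adj (vtx (fromℕ (2 ℕ.+ j))) (vtx zero)

module PosetNotions {n : ℕ} (P : FinPoset n) where
  open FinPoset P

  _≤P_ : Fin n → Fin n → Set
  x ≤P y = T (le x y)

  _<P_ : Fin n → Fin n → Set
  x <P y = x ≤P y × x ≢ y

  _⋖_ : Fin n → Fin n → Set
  y ⋖ x = y <P x × (∀ z → y <P z → z <P x → ⊥)

  HasseAdj : Fin n → Fin n → Set
  HasseAdj x y = x ⋖ y ⊎ y ⋖ x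

  IsMinimal : Fin n → Set
  IsMinimal y = ∀ z → z ≤P y → z ≡ y

  InM : Fin n → Set
  InM x = ∀ y → y ⋖ x → IsMinimal y

  _⋖M_ : Fin n → Fin n → Set
  y ⋖M x = InM y × InM x × y <P x × (∀ z → InM z → y <P z → z <P x → ⊥)

  HasseAdjM : Fin n → Fin n → Set
  HasseAdjM x y = x ⋖M y ⊎ y ⋖M x

  open Graph HasseAdj public using (HasCC)
  module GM = Graph HasseAdjM

  HasseConnected : Set
  HasseConnected = ∀ x y → Graph.ReachIn HasseAdj (λ _ → ⊤) x y

  HasMaximum : Set
  HasMaximum = ∃ λ t → ∀ x → x ≤P t

  MAcyclic : Set
  MAcyclic = ¬ GM.CycleIn InM

  SameCompM : Fin n → Fin n → Set
  SameCompM = GM.ReachIn InM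

  IsDownset : Subset n → Set
  IsDownset C = ∀ x y → y ∈ C → x ≤P y → x ∈ C

  IsConnectedDownset : Subset n → Set
  IsConnectedDownset C =
    (∃ λ x → x ∈ C) × IsDownset C × HasCC (λ x → x ∈ C) 1

  CompsMeeting : Subset n → Fin n → Set
  CompsMeeting C x = InM x × ∃ λ c → c ∈ C × InM c × SameCompM x c

  CCConditionFor : Subset n → Set
  CCConditionFor C =
    ∃ λ k → GM.HasCC (CompsMeeting C) k × HasCC (λ x → x ∈ C × InM x) k

  CCCondition : Set
  CCCondition = ∀ C → IsConnectedDownset C → CCConditionFor C

  _∼_ : Fin n → Fin n → Set
  x ∼ y = x ≡ y ⊎ (InM x × InM y × SameCompM x y)

  -- q : Fin n → Fin m presents P/∼: it is surjective and its fibres are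
  -- exactly the ∼-classes (Fin m is the set of classes).
  IsTreeQuotient : {m : ℕ} → (Fin n → Fin m) → Set
  IsTreeQuotient {m} q =
    (∀ (X : Fin m) → ∃ λ x → q x ≡ X) × (∀ x y → (q x ≡ q y) ⇔ (x ∼ y))

  QuotLe : {m : ℕ} → (Fin n → Fin m) → Fin m → Fin m → Set
  QuotLe q X Y = ∃ λ x → ∃ λ y → q x ≡ X × q y ≡ Y × x ≤P y

-- Braid cones and the Gorenstein property.
-- N = ℤ^m / ℤ(1,…,1); elements are represented by vectors Fin m → ℤ
-- up to ≈ (difference a constant vector).  Dual lattice M = {u : Σ u = 0}.

sumℤ : ∀ {m} → (Fin m → ℤ) → ℤ
sumℤ {zero}  u = 0ℤ
sumℤ {suc m} u = u zero ℤ.+ sumℤ (λ i → u (suc i))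

pairing : ∀ {m} → (Fin m → ℤ) → (Fin m → ℤ) → ℤ
pairing u v = sumℤ (λ i → u i ℤ.* v i)

module Braid {m : ℕ} (R : Fin m → Fin m → Set) where

  _≈_ : (Fin m → ℤ) → (Fin m → ℤ) → Set
  x ≈ y = ∃ λ (c : ℤ) → ∀ i → x i ≡ y i ℤ.+ c

  _·_ : ℕ → (Fin m → ℤ) → (Fin m → ℤ)
  (k · v) i = (+ k) ℤ.* v i

  _⊕_ : (Fin m → ℤ) → (Fin m → ℤ) → (Fin m → ℤ)
  (a ⊕ b) i = a i ℤ.+ b i

  InCone : (Fin m → ℤ) → Set
  InCone x = ∀ i j → R i j → x i ℤ.≤ x j

  NonZeroN : (Fin m → ℤ) → Set
  NonZeroN v = ¬ (∃ λ (c : ℤ) → ∀ i → v i ≡ c)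

  OnExtremalRay : (Fin m → ℤ) → Set
  OnExtremalRay v =
    InCone v × NonZeroN v ×
    (∀ (k : ℕ) a b → InCone a → InCone b → (a ⊕ b) ≈ (k · v) →
       ∃ λ (q : ℕ) → ∃ λ (p : ℕ) → q ≢ 0 × (q · a) ≈ (p · v))

  Primitive : (Fin m → ℤ) → Set
  Primitive v = ∀ (k : ℕ) w → v ≈ (k · w) → k ≡ 1

  IsRayGenerator : (Fin m → ℤ) → Set
  IsRayGenerator v = OnExtremalRay v × Primitive v

  Gorenstein : Set
  Gorenstein =
    ∃ λ (u : Fin m → ℤ) → sumℤ u ≡ 0ℤ ×
      (∀ v → IsRayGenerator v → pairing u v ≡ 1ℤ)

IsGorenstein : ∀ {m} → (Fin m → Fin m → Set) → Set
IsGorenstein R = Braid.Gorenstein R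

{-# OPTIONS --safe #-}
-- For a poset with top element t, the ray generators of the braid cone are (up to constants) the
-- indicators of up-sets whose complement D is a nonempty connected downset avoiding t, so U_P is
-- Gorenstein iff some w : P → ℤ has total weight −1 on every such D.  Pushing w forward along
-- P → P/∼ (summing over classes) works because such downsets of P/∼ pull back to such downsets of P.
-- Conversely, from w′ on P/∼ put w x = (number of lower covers of x) − 1 on M_P and w′ [x] elsewhere.
-- A class meeting D is a point outside M_P or a component of M_P; by the cc condition D cuts the
-- latter in a subtree of the forest M_P, whose weight is #edges − #vertices = −1 = w′ of that class
-- (a minimal element of P/∼).  Hence w(D) = w′(image of D) = −1.
module Submission where

open import Defs
open import Data.Bool using (Bool; true; false; not; _∧_; _∨_; T?; if_then_else_)
open import Data.Bool.Properties using (not-injective; not-involutive; ∧-conicalˡ; ∧-conicalʳ; ∧-zeroʳ) renaming (_≟_ to _≟ᵇ_)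
open import Data.Nat as ℕ using (ℕ; zero; suc; _≤_)
import Data.Nat.Properties as ℕP
open import Data.Integer as ℤ using (ℤ; +_; -_; 0ℤ; 1ℤ; -1ℤ; _+_; _-_; _*_; _<_; ∣_∣)
import Data.Integer.Properties as ℤP
open import Data.Integer.Tactic.RingSolver using (solve-∀)
open import Data.Fin using (Fin; zero; suc; toℕ; punchOut; fromℕ; inject₁)
open import Data.Fin.Properties using (_≟_; all?; any?; ¬∀⟶∃¬; pigeonhole; punchOut-injective; suc-injective)
open import Data.Fin.Subset using (_∈_) renaming (∣_∣ to ∣_∣ˢ)
open import Data.Fin.Subset.Properties using (p⊂q⇒∣p∣<∣q∣)
open import Data.Vec using (tabulate)
open import Data.Vec.Properties using ([]=⇒lookup; lookup⇒[]=; lookup∘tabulate)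
open import Data.Product using (_,_; _×_; proj₁; proj₂; ∃; Σ)
open import Data.Sum using (_⊎_; inj₁; inj₂)
open import Data.Empty using (⊥; ⊥-elim)
open import Function using (_∘_; flip; id)
open import Function.Bundles using (_⇔_; mk⇔; Equivalence)
open import Function.Construct.Composition using (_⇔-∘_)
open import Function.Construct.Symmetry using (⇔-sym)
open import Relation.Nullary using (Dec; yes; no; does; ¬_; ¬?)
open import Relation.Nullary.Decidable using (dec-true; dec-false; does-⇔; decidable-stable; _×-dec_; _→-dec_; map′; ¬¬-excluded-middle)
open import Relation.Nullary.Negation using (¬¬-map)
open import Relation.Binary.Definitions using (DecidableEquality)
open import Relation.Binary.PropositionalEquality
open import Relation.Binary.Construct.Closure.ReflexiveTransitive using (Star; ε; _◅_; _◅◅_; reverse)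
import Relation.Binary.Construct.Closure.ReflexiveTransitive as Star
open import Algebra.Properties.AbelianGroup ℤP.+-0-abelianGroup using () renaming (∙-cancelʳ to +-cancelʳ)

true≢false : true ≢ false
true≢false ()

1ℤ≢0ℤ : 1ℤ ≢ 0ℤ
1ℤ≢0ℤ ()

does-true⇒ : ∀ {A : Set} (a? : Dec A) → does a? ≡ true → A
does-true⇒ (yes a) _ = a

𝟙 : Bool → ℤ
𝟙 true  = 1ℤ
𝟙 false = 0ℤ

δ : ∀ {m} → Fin m → Fin m → ℤ
δ i j = 𝟙 (does (i ≟ j))

δ-≡ : ∀ {m} {i j : Fin m} → i ≡ j → δ i j ≡ 1ℤ
δ-≡ {i = i} {j} i≡j = cong 𝟙 (dec-true (i ≟ j) i≡j)

δ-≢ : ∀ {m} {i j : Fin m} → i ≢ j → δ i j ≡ 0ℤ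
δ-≢ {i = i} {j} i≢j = cong 𝟙 (dec-false (i ≟ j) i≢j)

𝟙-injective : ∀ b c → 𝟙 b ≡ 𝟙 c → b ≡ c
𝟙-injective true  true  _ = refl
𝟙-injective false false _ = refl

𝟙-not : ∀ b → 𝟙 (not b) ≡ 1ℤ - 𝟙 b
𝟙-not true  = refl
𝟙-not false = refl

𝟙-∨-split : ∀ u b → 𝟙 (u ∨ b) + 𝟙 (u ∨ not b) ≡ 1ℤ + 𝟙 u
𝟙-∨-split true  b     = refl
𝟙-∨-split false true  = refl
𝟙-∨-split false false = refl

0≤𝟙 : ∀ b → 0ℤ ℤ.≤ 𝟙 b
0≤𝟙 true  = ℤ.+≤+ ℕ.z≤n
0≤𝟙 false = ℤ.+≤+ ℕ.z≤n

𝟙≤1 : ∀ b → 𝟙 b ℤ.≤ 1ℤ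
𝟙≤1 true  = ℤ.+≤+ (ℕ.s≤s ℕ.z≤n)
𝟙≤1 false = ℤ.+≤+ ℕ.z≤n

sumℤ-cong : ∀ {m} {f g : Fin m → ℤ} → (∀ i → f i ≡ g i) → sumℤ f ≡ sumℤ g
sumℤ-cong {zero}  f≗g = refl
sumℤ-cong {suc m} f≗g = cong₂ _+_ (f≗g zero) (sumℤ-cong (f≗g ∘ suc))

sumℤ-zero : ∀ {m} (f : Fin m → ℤ) → (∀ i → f i ≡ 0ℤ) → sumℤ f ≡ 0ℤ
sumℤ-zero {zero}  f f≗0 = refl
sumℤ-zero {suc m} f f≗0 = cong₂ _+_ (f≗0 zero) (sumℤ-zero (f ∘ suc) (f≗0 ∘ suc))

sumℤ-+ : ∀ {m} (f g : Fin m → ℤ) → sumℤ (λ i → f i + g i) ≡ sumℤ f + sumℤ g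
sumℤ-+ {zero}  f g = refl
sumℤ-+ {suc m} f g = begin
  (f zero + g zero) + sumℤ (λ i → f (suc i) + g (suc i))
    ≡⟨ cong (_+_ (f zero + g zero)) (sumℤ-+ (f ∘ suc) (g ∘ suc)) ⟩
  (f zero + g zero) + (sumℤ (f ∘ suc) + sumℤ (g ∘ suc))
    ≡⟨ interchange (f zero) (g zero) _ _ ⟩
  (f zero + sumℤ (f ∘ suc)) + (g zero + sumℤ (g ∘ suc)) ∎
  where
  open ≡-Reasoning
  interchange : ∀ a b c d → (a + b) + (c + d) ≡ (a + c) + (b + d)
  interchange = solve-∀

sumℤ-*ˡ : ∀ {m} c (f : Fin m → ℤ) → sumℤ (λ i → c * f i) ≡ c * sumℤ f
sumℤ-*ˡ {zero}  c f = sym (ℤP.*-zeroʳ c)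
sumℤ-*ˡ {suc m} c f =
  trans (cong (_+_ (c * f zero)) (sumℤ-*ˡ c (f ∘ suc))) (sym (ℤP.*-distribˡ-+ c (f zero) _))

sumℤ-*ʳ : ∀ {m} c (f : Fin m → ℤ) → sumℤ (λ i → f i * c) ≡ sumℤ f * c
sumℤ-*ʳ c f = trans (sumℤ-cong (λ i → ℤP.*-comm (f i) c)) (trans (sumℤ-*ˡ c f) (ℤP.*-comm c _))

sumℤ-neg : ∀ {m} (f : Fin m → ℤ) → sumℤ (λ i → - f i) ≡ - sumℤ f
sumℤ-neg f = trans (sumℤ-cong (λ i → sym (ℤP.-1*i≡-i (f i))))
                   (trans (sumℤ-*ˡ -1ℤ f) (ℤP.-1*i≡-i _))

sumℤ-swap : ∀ {m n} (f : Fin m → Fin n → ℤ) →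
  sumℤ (λ i → sumℤ (f i)) ≡ sumℤ (λ j → sumℤ (λ i → f i j))
sumℤ-swap {zero}  f = sym (sumℤ-zero (λ j → sumℤ (λ i → f i j)) (λ _ → refl))
sumℤ-swap {suc m} f = trans (cong (_+_ (sumℤ (f zero))) (sumℤ-swap (f ∘ suc)))
                            (sym (sumℤ-+ (f zero) _))

sumℤ-δ : ∀ {m} (i : Fin m) (h : Fin m → ℤ) → sumℤ (λ j → δ i j * h j) ≡ h i
sumℤ-δ {suc m} zero h = begin
  1ℤ * h zero + sumℤ (λ j → 0ℤ * h (suc j))
    ≡⟨ cong (_+_ (1ℤ * h zero)) (sumℤ-zero (λ j → 0ℤ * h (suc j)) (λ _ → refl)) ⟩
  1ℤ * h zero + 0ℤ  ≡⟨ ℤP.+-identityʳ _ ⟩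
  1ℤ * h zero       ≡⟨ ℤP.*-identityˡ _ ⟩
  h zero            ∎
  where open ≡-Reasoning
sumℤ-δ {suc m} (suc i) h = trans (ℤP.+-identityˡ _) (sumℤ-δ i (h ∘ suc))

pairing-− : ∀ {m} (u u′ v : Fin m → ℤ) → pairing (λ i → u i - u′ i) v ≡ pairing u v - pairing u′ v
pairing-− u u′ v = begin
  sumℤ (λ i → (u i - u′ i) * v i)       ≡⟨ sumℤ-cong (λ i → distrib (u i) (u′ i) (v i)) ⟩
  sumℤ (λ i → u i * v i + - (u′ i * v i)) ≡⟨ sumℤ-+ (λ i → u i * v i) (λ i → - (u′ i * v i)) ⟩
  pairing u v + sumℤ (λ i → - (u′ i * v i)) ≡⟨ cong (_+_ (pairing u v)) (sumℤ-neg (λ i → u′ i * v i)) ⟩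
  pairing u v - pairing u′ v            ∎
  where
  open ≡-Reasoning
  distrib : ∀ a b c → (a - b) * c ≡ a * c + - (b * c)
  distrib = solve-∀

pairing-+const : ∀ {m} (u v : Fin m → ℤ) c → pairing u (λ i → v i + c) ≡ pairing u v + sumℤ u * c
pairing-+const u v c = begin
  sumℤ (λ i → u i * (v i + c))          ≡⟨ sumℤ-cong (λ i → ℤP.*-distribˡ-+ (u i) (v i) c) ⟩
  sumℤ (λ i → u i * v i + u i * c)      ≡⟨ sumℤ-+ (λ i → u i * v i) (λ i → u i * c) ⟩
  pairing u v + sumℤ (λ i → u i * c)    ≡⟨ cong (_+_ (pairing u v)) (sumℤ-*ʳ c u) ⟩
  pairing u v + sumℤ u * c              ∎
  where open ≡-Reasoning

+-cancel-≤ˡ : ∀ {x x′ y y′ : ℤ} → x ℤ.≤ x′ → y ℤ.≤ y′ → x + y ≡ x′ + y′ → x ≡ x′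
+-cancel-≤ˡ {x} {x′} x≤x′ y≤y′ eq with x ℤ.≟ x′
... | yes x≡x′ = x≡x′
... | no  x≢x′ = ⊥-elim (ℤP.<-irrefl eq (ℤP.+-mono-<-≤ (ℤP.≤∧≢⇒< x≤x′ x≢x′) y≤y′))

¬¬-Π-Fin : ∀ {n} {P : Fin n → Set} → (∀ i → ¬ ¬ P i) → ¬ ¬ (∀ i → P i)
¬¬-Π-Fin {zero}  _    k = k (λ ())
¬¬-Π-Fin {suc n} ¬¬P k = ¬¬P zero λ P₀ → ¬¬-Π-Fin (¬¬P ∘ suc) λ Pₛ →
  k λ { zero → P₀ ; (suc i) → Pₛ i }

¬¬-decide : ∀ {n} {P : Fin n → Set} → ¬ ¬ (∀ i → Dec (P i))
¬¬-decide = ¬¬-Π-Fin (λ _ → ¬¬-excluded-middle)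

Fin-injective⇒surjective : ∀ {k} (σ : Fin k → Fin k) → (∀ a b → σ a ≡ σ b → a ≡ b) →
                           ∀ i → ∃ λ j → σ j ≡ i
Fin-injective⇒surjective {suc k} σ σ-inj i with any? (λ j → σ j ≟ i)
... | yes hit = hit
... | no  miss with pigeonhole (ℕP.n<1+n k) (λ j → punchOut (λ σj≡i → miss (j , sym σj≡i)))
... | a , b , a<b , eq = ⊥-elim (ℕP.<-irrefl (cong toℕ (σ-inj a b
        (punchOut-injective (λ i≡σa → miss (a , sym i≡σa)) (λ i≡σb → miss (b , sym i≡σb)) eq))) a<b)

Fin-surjective⇒injective : ∀ {k} (h : Fin k → Fin k) → (∀ j → ∃ λ i → h i ≡ j) →
                           ∀ a b → h a ≡ h b → a ≡ b
Fin-surjective⇒injective h h-surj a b ha≡hb = begin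
  a           ≡⟨ sym (proj₂ (σ-surj a)) ⟩
  σ (index a) ≡⟨ cong σ (trans (index≡h a) (trans ha≡hb (sym (index≡h b)))) ⟩
  σ (index b) ≡⟨ proj₂ (σ-surj b) ⟩
  b           ∎
  where
  open ≡-Reasoning
  σ : _ → _
  σ j = proj₁ (h-surj j)
  h∘σ≡id : ∀ j → h (σ j) ≡ j
  h∘σ≡id j = proj₂ (h-surj j)
  σ-surj = Fin-injective⇒surjective σ λ i j σi≡σj →
    trans (sym (h∘σ≡id i)) (trans (cong h σi≡σj) (h∘σ≡id j))
  index : _ → _
  index a = proj₁ (σ-surj a)
  index≡h : ∀ a → index a ≡ h a
  index≡h a = trans (sym (h∘σ≡id (index a))) (cong h (proj₂ (σ-surj a)))

module _ {n : ℕ} where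

  ∈-tabulate⁺ : ∀ {S : Fin n → Bool} {x} → S x ≡ true → x ∈ tabulate S
  ∈-tabulate⁺ {S} {x} Sx = lookup⇒[]= x (tabulate S) (trans (lookup∘tabulate S x) Sx)

  ∈-tabulate⁻ : ∀ {S : Fin n → Bool} {x} → x ∈ tabulate S → S x ≡ true
  ∈-tabulate⁻ {S} {x} x∈ = trans (sym (lookup∘tabulate S x)) ([]=⇒lookup x∈)

  size : (Fin n → Bool) → ℕ
  size S = ∣ tabulate S ∣ˢ

  size-< : ∀ {S S′ : Fin n → Bool} → (∀ x → S x ≡ true → S′ x ≡ true) →
           ∀ y → S′ y ≡ true → S y ≡ false → size S ℕ.< size S′
  size-< S⊆S′ y S′y Sy = p⊂q⇒∣p∣<∣q∣
    ( (λ x∈S → ∈-tabulate⁺ (S⊆S′ _ (∈-tabulate⁻ x∈S)))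
    , y , ∈-tabulate⁺ S′y , λ y∈S → true≢false (trans (sym (∈-tabulate⁻ y∈S)) Sy))

last-step : ∀ {A : Set} {R : A → A → Set} {x y} → Star R x y → x ≢ y → ∃ λ w → Star R x w × R w y
last-step {R = R} xs x≢y with reverse {U = flip R} id xs
... | ε      = ⊥-elim (x≢y refl)
... | r ◅ rs = _ , reverse id rs , r

module _ {n : ℕ} {adj : Fin n → Fin n → Set} where
  open Graph adj using (AdjIn)

  AdjIn-restrict : ∀ {S T : Fin n → Set} {x} → (∀ {z} → Star (AdjIn S) x z → S z → T z) →
                   ∀ {y} → Star (AdjIn S) x y → Star (AdjIn T) x y
  AdjIn-restrict inT ε = ε
  AdjIn-restrict inT (e@(Sx , Sz , x—z) ◅ es) =
    (inT ε Sx , inT (e ◅ ε) Sz , x—z) ◅ AdjIn-restrict (inT ∘ (e ◅_)) es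

infixr 5 _∷_
data Walk {A : Set} (E : A → A → Set) : ℕ → A → A → Set where
  []  : ∀ {x} → Walk E 0 x x
  _∷_ : ∀ {r x z y} → E x z → Walk E r z y → Walk E (suc r) x y

module Walks {A : Set} {E : A → A → Set} where

  vertex : ∀ {r x y} → Walk E r x y → Fin (suc r) → A
  vertex {x = x} w       zero    = x
  vertex (_ ∷ w) (suc i) = vertex w i

  vertex-last : ∀ {r x y} (w : Walk E r x y) → vertex w (fromℕ r) ≡ y
  vertex-last []      = refl
  vertex-last (_ ∷ w) = vertex-last w

  vertex-step : ∀ {r x y} (w : Walk E r x y) (i : Fin r) → E (vertex w (inject₁ i)) (vertex w (suc i))
  vertex-step (e ∷ _)       zero    = e
  vertex-step (_ ∷ (e ∷ w)) (suc i) = vertex-step (e ∷ w) i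

  vertex-all : (G : A → Set) → (∀ {a b} → E a b → G b) →
               ∀ {r x y} (w : Walk E r x y) → G x → ∀ i → G (vertex w i)
  vertex-all G E⇒G w       Gx zero    = Gx
  vertex-all G E⇒G (e ∷ w) Gx (suc i) = vertex-all G E⇒G w (E⇒G e) i

  Star⇒Walk : ∀ {x y} → Star E x y → ∃ λ r → Walk E r x y
  Star⇒Walk ε        = 0 , []
  Star⇒Walk (e ◅ es) = let r , w = Star⇒Walk es in suc r , e ∷ w

  IsPath : ∀ {r x y} → Walk E r x y → Set
  IsPath {r} w = ∀ (i j : Fin (suc r)) → vertex w i ≡ vertex w j → i ≡ j

  Path : A → A → Set
  Path x y = ∃ λ r → Σ (Walk E r x y) IsPath

  suffix-path : ∀ {r x y} (w : Walk E r x y) → IsPath w → ∀ i → Path (vertex w i) y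
  suffix-path w       w-path zero    = _ , w , w-path
  suffix-path (_ ∷ w) w-path (suc i) = suffix-path w (λ j k eq → suc-injective (w-path (suc j) (suc k) eq)) i

  Star⇒Path : DecidableEquality A → ∀ {x y} → Star E x y → Path x y
  Star⇒Path _≟ᴬ_ es = erase (proj₂ (Star⇒Walk es))
    where
    erase : ∀ {r x y} → Walk E r x y → Path x y
    erase []  = 0 , [] , λ { zero zero _ → refl }
    erase {x = x} (e ∷ w) with erase w
    ... | _ , w′ , w′-path with any? (λ i → vertex w′ i ≟ᴬ x)
    ... | yes (i , refl) = suffix-path w′ w′-path i
    ... | no  x∉w′       = _ , e ∷ w′ , ew′-path
      where
      ew′-path : IsPath (e ∷ w′)
      ew′-path zero    zero    _  = refl
      ew′-path zero    (suc j) eq = ⊥-elim (x∉w′ (j , sym eq))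
      ew′-path (suc i) zero    eq = ⊥-elim (x∉w′ (i , eq))
      ew′-path (suc i) (suc j) eq = cong suc (w′-path i j eq)

-- When t is above everything, the ray generators of σ_R are, up to constants, the indicator vectors
-- χ U of the cuts U: up-sets containing t whose complement is nonempty and connected.
module TopCone {m : ℕ} (R : Fin m → Fin m → Set) (t : Fin m) (top : ∀ i → R i t) where
  open Braid R

  χ : (Fin m → Bool) → Fin m → ℤ
  χ U i = 𝟙 (U i)

  IsUpset : (Fin m → Bool) → Set
  IsUpset U = ∀ i j → R i j → U i ≡ true → U j ≡ true

  ConstantOn : (Fin m → Bool) → (Fin m → Bool) → Set
  ConstantOn S T = ∀ i j → R i j → S i ≡ true → S j ≡ true → T i ≡ T j

  IsConnected : (Fin m → Bool) → Set
  IsConnected S = ∀ T → ConstantOn S T → (∃ λ i → S i ≡ true × T i ≡ true) →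
                  ∀ i → S i ≡ true → T i ≡ true

  record IsCut (U : Fin m → Bool) : Set where
    field
      upset     : IsUpset U
      top∈      : U t ≡ true
      outside   : ∃ λ d → U d ≡ false
      connected : IsConnected (not ∘ U)

  CutWeight : (Fin m → ℤ) → Set
  CutWeight w = ∀ U → IsCut U → pairing w (χ (not ∘ U)) ≡ -1ℤ

  χ-upset-cone : ∀ {U} → IsUpset U → InCone (χ U)
  χ-upset-cone {U} up i j r with U i in Ui
  ... | true  rewrite up i j r Ui = ℤP.≤-refl
  ... | false = 0≤𝟙 (U j)

  primitive-two-valued : ∀ v i j → v j - v i ≡ 1ℤ → Primitive v
  primitive-two-valued v i j gap k w (c , v≈kw) =
    ℕP.m*n≡1⇒m≡1 k ∣ w j - w i ∣ (trans (sym (ℤP.abs-* (+ k) (w j - w i))) (cong ∣_∣ k[wj-wi]≡1))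
    where
    open ≡-Reasoning
    scale : ∀ k a b c → k * (a - b) ≡ (k * a + c) - (k * b + c)
    scale = solve-∀
    k[wj-wi]≡1 : + k * (w j - w i) ≡ 1ℤ
    k[wj-wi]≡1 = begin
      + k * (w j - w i)                   ≡⟨ scale (+ k) (w j) (w i) c ⟩
      (+ k * w j + c) - (+ k * w i + c)   ≡⟨ cong₂ _-_ (sym (v≈kw j)) (sym (v≈kw i)) ⟩
      v j - v i                           ≡⟨ gap ⟩
      1ℤ                                  ∎

  _∝_ : (Fin m → ℤ) → (Fin m → ℤ) → Set
  a ∝ v = ∃ λ q → ∃ λ p → q ≢ 0 × (q · a) ≈ (p · v)

  ∝-level-sets : ∀ {a v} → a ∝ v → ∀ i j → v i ≡ v j → a i ≡ a j
  ∝-level-sets (zero , _ , q≢0 , _) _ _ _ = ⊥-elim (q≢0 refl)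
  ∝-level-sets {a} (suc q , p , _ , c , qa≈pv) i j vi≡vj =
    ℤP.*-cancelˡ-≡ (+ suc q) (a i) (a j)
      (trans (qa≈pv i) (trans (cong (λ z → + p * z + c) vi≡vj) (sym (qa≈pv j))))

  ∝-separates : ∀ {a v} → a ∝ v → ∀ i j → a i ≢ a j → ∀ k l → a k ≡ a l → v k ≡ v l
  ∝-separates (zero , _ , q≢0 , _) _ _ _ _ _ _ = ⊥-elim (q≢0 refl)
  ∝-separates {a} {v} (suc q , zero , _ , c , qa≈pv) i j ai≢aj _ _ _ =
    ⊥-elim (ai≢aj (ℤP.*-cancelˡ-≡ (+ suc q) (a i) (a j) (trans (≡c i) (sym (≡c j)))))
    where
    ≡c : ∀ k → + suc q * a k ≡ c
    ≡c k = trans (qa≈pv k) (trans (cong (_+ c) (ℤP.*-zeroˡ (v k))) (ℤP.+-identityˡ c))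
  ∝-separates {a} {v} (suc q , suc p , _ , c , qa≈pv) _ _ _ k l ak≡al =
    ℤP.*-cancelˡ-≡ (+ suc p) (v k) (v l)
      (+-cancelʳ c _ _ (trans (sym (qa≈pv k)) (trans (cong (λ z → + suc q * z) ak≡al) (qa≈pv l))))

  module _ {U : Fin m → Bool} (cut : IsCut U) where
    open IsCut cut
    private
      d = proj₁ outside
      Ud≡false = proj₂ outside

    χ-cut-nonconstant : NonZeroN (χ U)
    χ-cut-nonconstant (c , χU≡c) with trans (χU≡c t) (sym (χU≡c d))
    ... | 1≡0 rewrite top∈ | Ud≡false = 1ℤ≢0ℤ 1≡0

    χ-cut-primitive : Primitive (χ U)
    χ-cut-primitive = primitive-two-valued (χ U) d t (cong₂ (λ x y → 𝟙 x - 𝟙 y) top∈ Ud≡false)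

    χ-cut-extremal : ∀ k a b → InCone a → InCone b → (a ⊕ b) ≈ (k · χ U) → a ∝ χ U
    χ-cut-extremal k a b a-cone b-cone (c , a+b≈kχ) =
      1 , ∣ a t - a d ∣ , (λ ()) , a d , a≈
      where
      same-level : ∀ i j → U i ≡ U j → a i + b i ≡ a j + b j
      same-level i j Ui≡Uj =
        trans (a+b≈kχ i) (trans (cong (λ z → + k * 𝟙 z + c) Ui≡Uj) (sym (a+b≈kχ j)))
      -- a and b are monotone, so a constant sum forces both to be constant
      tight : ∀ i j → R i j → U i ≡ U j → a i ≡ a j
      tight i j r Ui≡Uj = +-cancel-≤ˡ (a-cone i j r) (b-cone i j r) (same-level i j Ui≡Uj)
      a-on-complement : ∀ i → U i ≡ false → a i ≡ a d
      a-on-complement i Ui≡false =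
        does-true⇒ (a i ℤ.≟ a d)
          (connected (λ j → does (a j ℤ.≟ a d)) constant
                     (d , cong not Ud≡false , dec-true (a d ℤ.≟ a d) refl) i (cong not Ui≡false))
        where
        constant : ConstantOn (not ∘ U) (λ j → does (a j ℤ.≟ a d))
        constant i j r ¬Ui ¬Uj = cong (λ z → does (z ℤ.≟ a d))
          (tight i j r (not-injective (trans ¬Ui (sym ¬Uj))))
      a-on-cut : ∀ i → U i ≡ true → a i ≡ a t
      a-on-cut i Ui = tight i t (top i) (trans Ui (sym top∈))
      a≈ : ∀ i → + 1 * a i ≡ + ∣ a t - a d ∣ * χ U i + a d
      a≈ i with U i in Ui
      ... | true  = begin
        + 1 * a i                       ≡⟨ ℤP.*-identityˡ (a i) ⟩
        a i                             ≡⟨ a-on-cut i Ui ⟩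
        a t                             ≡⟨ sym (undo (a t) (a d)) ⟩
        (a t - a d) * 1ℤ + a d          ≡⟨ cong (λ z → z * 1ℤ + a d) (sym ∣at-ad∣) ⟩
        + ∣ a t - a d ∣ * 1ℤ + a d       ∎
        where
        open ≡-Reasoning
        undo : ∀ x y → (x - y) * 1ℤ + y ≡ x
        undo = solve-∀
        ∣at-ad∣ : + ∣ a t - a d ∣ ≡ a t - a d
        ∣at-ad∣ = ℤP.0≤i⇒+∣i∣≡i (ℤP.i≤j⇒0≤j-i (a-cone d t (top d)))
      ... | false = begin
        + 1 * a i                       ≡⟨ ℤP.*-identityˡ (a i) ⟩
        a i                             ≡⟨ a-on-complement i Ui ⟩
        a d                             ≡⟨ sym (ℤP.+-identityˡ (a d)) ⟩
        0ℤ + a d                        ≡⟨ cong (_+ a d) (sym (ℤP.*-zeroʳ (+ ∣ a t - a d ∣))) ⟩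
        + ∣ a t - a d ∣ * 0ℤ + a d       ∎
        where open ≡-Reasoning

    χ-cut-isRayGenerator : IsRayGenerator (χ U)
    χ-cut-isRayGenerator =
      (χ-upset-cone upset , χ-cut-nonconstant , χ-cut-extremal) , χ-cut-primitive

  χ-∨-cone : ∀ {U T} → IsUpset U → ConstantOn (not ∘ U) T → InCone (λ i → 𝟙 (U i ∨ T i))
  χ-∨-cone {U} {T} up constant i j r with U i in Ui | U j in Uj
  ... | true  | true  = ℤP.≤-refl
  ... | true  | false = ⊥-elim (true≢false (trans (sym (up i j r Ui)) Uj))
  ... | false | true  = 𝟙≤1 (T i)
  ... | false | false rewrite constant i j r (cong not Ui) (cong not Uj) = ℤP.≤-refl

  -- Splitting v = χ U + (v − χ U) inside the cone, extremality makes v constant on U and on its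
  -- complement, and primitivity makes the two values differ by 1.
  module RayGenerator {v : Fin m → ℤ} (ray : IsRayGenerator v) where
    private
      v-cone      = proj₁ (proj₁ ray)
      v-nonconst  = proj₁ (proj₂ (proj₁ ray))
      v-extremal  = proj₂ (proj₂ (proj₁ ray))
      v-primitive = proj₂ ray

    below-top : ∃ λ lo → v lo < v t
    below-top = lo , ℤP.≤∧≢⇒< (v-cone lo t (top lo)) vlo≢vt
      where
      not-all-top : ∃ λ i → v i ≢ v t
      not-all-top = ¬∀⟶∃¬ m (λ i → v i ≡ v t) (λ i → v i ℤ.≟ v t) (λ all → v-nonconst (v t , all))
      lo = proj₁ not-all-top
      vlo≢vt = proj₂ not-all-top

    lo : Fin m
    lo = proj₁ below-top

    U : Fin m → Bool
    U i = not (does (v i ℤ.≤? v lo))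

    private
      U-spec : ∀ i → (U i ≡ true × v lo < v i) ⊎ (U i ≡ false × v i ℤ.≤ v lo)
      U-spec i with v i ℤ.≤? v lo
      ... | yes vi≤vlo = inj₂ (refl , vi≤vlo)
      ... | no  vi≰vlo = inj₁ (refl , ℤP.≰⇒> vi≰vlo)

      U-true : ∀ i → v lo < v i → U i ≡ true
      U-true i vlo<vi with U-spec i
      ... | inj₁ (Ui , _)    = Ui
      ... | inj₂ (_ , vi≤vlo) = ⊥-elim (ℤP.<⇒≱ vlo<vi vi≤vlo)

      U-upset : IsUpset U
      U-upset i j r Ui with U-spec i
      ... | inj₁ (_ , vlo<vi) = U-true j (ℤP.<-≤-trans vlo<vi (v-cone i j r))
      ... | inj₂ (¬Ui , _)    = ⊥-elim (true≢false (trans (sym Ui) ¬Ui))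

      U-top : U t ≡ true
      U-top = U-true t (proj₂ below-top)

      U-lo : U lo ≡ false
      U-lo = cong not (dec-true (v lo ℤ.≤? v lo) ℤP.≤-refl)

      v−χU-cone : InCone (λ i → v i - χ U i)
      v−χU-cone i j r with U-spec i | U-spec j
      ... | inj₁ (Ui , _) | inj₁ (Uj , _) rewrite Ui | Uj = ℤP.+-monoˡ-≤ -1ℤ (v-cone i j r)
      ... | inj₂ (Ui , _) | inj₂ (Uj , _) rewrite Ui | Uj = ℤP.+-monoˡ-≤ 0ℤ (v-cone i j r)
      ... | inj₁ (_ , vlo<vi) | inj₂ (_ , vj≤vlo) =
        ⊥-elim (ℤP.<⇒≱ (ℤP.<-≤-trans vlo<vi (v-cone i j r)) vj≤vlo)
      ... | inj₂ (Ui , vi≤vlo) | inj₁ (Uj , vlo<vj) rewrite Ui | Uj =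
        subst₂ ℤ._≤_ (shift (v i)) refl (ℤP.+-monoˡ-≤ -1ℤ (ℤP.i<j⇒suc[i]≤j (ℤP.≤-<-trans vi≤vlo vlo<vj)))
        where
        shift : ∀ x → (1ℤ + x) - 1ℤ ≡ x - 0ℤ
        shift = solve-∀

      χU+rest : ((χ U) ⊕ (λ i → v i - χ U i)) ≈ (1 · v)
      χU+rest = 0ℤ , λ i → split (χ U i) (v i)
        where
        split : ∀ x y → x + (y - x) ≡ 1ℤ * y + 0ℤ
        split = solve-∀

      χU∝v : χ U ∝ v
      χU∝v = v-extremal 1 (χ U) _ (χ-upset-cone U-upset) v−χU-cone χU+rest

      same-value : ∀ i j → U i ≡ U j → v i ≡ v j
      same-value i j Ui≡Uj =
        ∝-separates χU∝v t lo (λ 1≡0 → 1ℤ≢0ℤ (trans (sym (cong 𝟙 U-top)) (trans 1≡0 (cong 𝟙 U-lo))))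
          i j (cong 𝟙 Ui≡Uj)

      gap : ℕ
      gap = ∣ v t - v lo ∣

      +gap : + gap ≡ v t - v lo
      +gap = ℤP.0≤i⇒+∣i∣≡i (ℤP.i≤j⇒0≤j-i (ℤP.<⇒≤ (proj₂ below-top)))

      v≡gap·χU+vlo : ∀ i → v i ≡ + gap * 𝟙 (U i) + v lo
      v≡gap·χU+vlo i with U i in Ui
      ... | true  = begin
        v i                         ≡⟨ same-value i t (trans Ui (sym U-top)) ⟩
        v t                         ≡⟨ sym (undo (v t) (v lo)) ⟩
        (v t - v lo) * 1ℤ + v lo    ≡⟨ cong (λ z → z * 1ℤ + v lo) (sym +gap) ⟩
        + gap * 1ℤ + v lo           ∎
        where
        open ≡-Reasoning
        undo : ∀ x y → (x - y) * 1ℤ + y ≡ x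
        undo = solve-∀
      ... | false = begin
        v i                         ≡⟨ same-value i lo (trans Ui (sym U-lo)) ⟩
        v lo                        ≡⟨ sym (ℤP.+-identityˡ (v lo)) ⟩
        0ℤ + v lo                   ≡⟨ cong (_+ v lo) (sym (ℤP.*-zeroʳ (+ gap))) ⟩
        + gap * 0ℤ + v lo           ∎
        where open ≡-Reasoning

      gap≡1 : gap ≡ 1
      gap≡1 = v-primitive gap (χ U) (v lo , v≡gap·χU+vlo)

    v≡χU+vlo : ∀ i → v i ≡ χ U i + v lo
    v≡χU+vlo i = trans (v≡gap·χU+vlo i)
                   (trans (cong (λ g → + g * 𝟙 (U i) + v lo) gap≡1)
                          (cong (_+ v lo) (ℤP.*-identityˡ (𝟙 (U i)))))

    private
      complement-connected : IsConnected (not ∘ U)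
      complement-connected T constant (d₁ , ¬Ud₁ , Td₁) i ¬Ui =
        begin
          T i            ≡⟨ cong (_∨ T i) (sym (not-injective ¬Ui)) ⟩
          U i ∨ T i      ≡⟨ 𝟙-injective _ _ (∝-level-sets a∝v i d₁ vi≡vd₁) ⟩
          U d₁ ∨ T d₁    ≡⟨ cong₂ _∨_ (not-injective ¬Ud₁) Td₁ ⟩
          true           ∎
        where
        a b : Fin m → ℤ
        a j = 𝟙 (U j ∨ T j)
        b j = 𝟙 (U j ∨ not (T j))
        a+b≈v : (a ⊕ b) ≈ (1 · v)
        a+b≈v = 1ℤ - v lo , λ j → begin
          𝟙 (U j ∨ T j) + 𝟙 (U j ∨ not (T j))  ≡⟨ 𝟙-∨-split (U j) (T j) ⟩
          1ℤ + 𝟙 (U j)                          ≡⟨ regroup (𝟙 (U j)) (v lo) ⟩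
          1ℤ * (𝟙 (U j) + v lo) + (1ℤ - v lo)   ≡⟨ cong (λ z → 1ℤ * z + (1ℤ - v lo)) (sym (v≡χU+vlo j)) ⟩
          1ℤ * v j + (1ℤ - v lo)                ∎
          where
          open ≡-Reasoning
          regroup : ∀ x y → 1ℤ + x ≡ 1ℤ * (x + y) + (1ℤ - y)
          regroup = solve-∀
        a∝v : a ∝ v
        a∝v = v-extremal 1 a b (χ-∨-cone U-upset constant)
                (χ-∨-cone U-upset (λ j k r ¬Uj ¬Uk → cong not (constant j k r ¬Uj ¬Uk))) a+b≈v
        v-off : ∀ j → not (U j) ≡ true → v j ≡ v lo
        v-off j ¬Uj =
          trans (v≡χU+vlo j) (trans (cong (λ z → 𝟙 z + v lo) (not-injective ¬Uj)) (ℤP.+-identityˡ (v lo)))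
        vi≡vd₁ : v i ≡ v d₁
        vi≡vd₁ = trans (v-off i ¬Ui) (sym (v-off d₁ ¬Ud₁))
        open ≡-Reasoning

    U-isCut : IsCut U
    U-isCut = record
      { upset = U-upset ; top∈ = U-top ; outside = lo , U-lo ; connected = complement-connected }

  pairing-complement : ∀ (u : Fin m → ℤ) U → pairing u (χ (not ∘ U)) ≡ sumℤ u - pairing u (χ U)
  pairing-complement u U = begin
    sumℤ (λ i → u i * 𝟙 (not (U i)))
      ≡⟨ sumℤ-cong (λ i → trans (cong (u i *_) (𝟙-not (U i))) (distrib (u i) (𝟙 (U i)))) ⟩
    sumℤ (λ i → u i + - (u i * 𝟙 (U i)))
      ≡⟨ sumℤ-+ u (λ i → - (u i * 𝟙 (U i))) ⟩
    sumℤ u + sumℤ (λ i → - (u i * 𝟙 (U i)))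
      ≡⟨ cong (_+_ (sumℤ u)) (sumℤ-neg (λ i → u i * 𝟙 (U i))) ⟩
    sumℤ u - pairing u (χ U) ∎
    where
    open ≡-Reasoning
    distrib : ∀ a b → a * (1ℤ - b) ≡ a + - (a * b)
    distrib = solve-∀

  gorenstein⇒cutWeight : Gorenstein → ∃ CutWeight
  gorenstein⇒cutWeight (u , Σu≡0 , ray⇒1) = u , λ U cut →
    trans (pairing-complement u U) (cong₂ _-_ Σu≡0 (ray⇒1 (χ U) (χ-cut-isRayGenerator cut)))

  cutWeight⇒gorenstein : ∃ CutWeight → Gorenstein
  cutWeight⇒gorenstein (w , cut⇒-1) = u , Σu≡0 , ray⇒1
    where
    S : ℤ
    S = sumℤ w
    e : Fin m → ℤ
    e i = δ t i * S
    u : Fin m → ℤ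
    u i = w i - e i
    Σe≡S : sumℤ e ≡ S
    Σe≡S = sumℤ-δ t (λ _ → S)
    Σu≡0 : sumℤ u ≡ 0ℤ
    Σu≡0 = begin
      sumℤ u                  ≡⟨ sumℤ-+ w (λ i → - e i) ⟩
      S + sumℤ (λ i → - e i)  ≡⟨ cong (_+_ S) (trans (sumℤ-neg e) (cong -_ Σe≡S)) ⟩
      S - S                   ≡⟨ ℤP.+-inverseʳ S ⟩
      0ℤ                      ∎
      where open ≡-Reasoning
    cut⇒1 : ∀ U → IsCut U → pairing u (χ U) ≡ 1ℤ
    cut⇒1 U cut = begin
      pairing u (χ U)                ≡⟨ pairing-− w e (χ U) ⟩
      pairing w (χ U) - pairing e (χ U) ≡⟨ cong₂ _-_ ⟨w,χU⟩≡S+1 ⟨e,χU⟩≡S ⟩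
      (S + 1ℤ) - S                   ≡⟨ cancel S ⟩
      1ℤ                             ∎
      where
      open ≡-Reasoning
      cancel : ∀ s → (s + 1ℤ) - s ≡ 1ℤ
      cancel = solve-∀
      solve-for : ∀ s x → s - x ≡ -1ℤ → x ≡ s + 1ℤ
      solve-for s x eq = trans (sym (involution s x)) (cong (_-_ s) eq)
        where
        involution : ∀ s x → s - (s - x) ≡ x
        involution = solve-∀
      ⟨w,χU⟩≡S+1 : pairing w (χ U) ≡ S + 1ℤ
      ⟨w,χU⟩≡S+1 = solve-for S _ (trans (sym (pairing-complement w U)) (cut⇒-1 U cut))
      ⟨e,χU⟩≡S : pairing e (χ U) ≡ S
      ⟨e,χU⟩≡S = begin
        sumℤ (λ i → δ t i * S * 𝟙 (U i))   ≡⟨ sumℤ-cong (λ i → ℤP.*-assoc (δ t i) S (𝟙 (U i))) ⟩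
        sumℤ (λ i → δ t i * (S * 𝟙 (U i))) ≡⟨ sumℤ-δ t (λ i → S * 𝟙 (U i)) ⟩
        S * 𝟙 (U t)                        ≡⟨ cong (λ b → S * 𝟙 b) (IsCut.top∈ cut) ⟩
        S * 1ℤ                             ≡⟨ ℤP.*-identityʳ S ⟩
        S                                  ∎
    ray⇒1 : ∀ v → IsRayGenerator v → pairing u v ≡ 1ℤ
    ray⇒1 v ray = begin
      pairing u v                                      ≡⟨ sumℤ-cong (λ i → cong (u i *_) (v≡χU+vlo i)) ⟩
      pairing u (λ i → χ U i + v lo)                   ≡⟨ pairing-+const u (χ U) (v lo) ⟩
      pairing u (χ U) + sumℤ u * v lo                  ≡⟨ cong₂ (λ x y → x + y * v lo) (cut⇒1 U U-isCut) Σu≡0 ⟩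
      1ℤ + 0ℤ * v lo                                   ≡⟨ cong (_+_ 1ℤ) (ℤP.*-zeroˡ (v lo)) ⟩
      1ℤ                                               ∎
      where
      open ≡-Reasoning
      open RayGenerator ray

  gorenstein⇔cutWeight : Gorenstein ⇔ ∃ CutWeight
  gorenstein⇔cutWeight = mk⇔ gorenstein⇒cutWeight cutWeight⇒gorenstein

module PosetFacts {n : ℕ} (P : FinPoset n) where
  open FinPoset P using (le) renaming (refl to ≤-refl; antisym to ≤-antisym; trans to ≤-trans′)
  open PosetNotions P

  ≤-trans : ∀ {x y z} → x ≤P y → y ≤P z → x ≤P z
  ≤-trans {x} {y} {z} = ≤-trans′ x y z

  _≤?_ : ∀ x y → Dec (x ≤P y)
  x ≤? y = T? (le x y)

  _<?_ : ∀ x y → Dec (x <P y)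
  x <? y = (x ≤? y) ×-dec ¬? (x ≟ y)

  _⋖?_ : ∀ y x → Dec (y ⋖ x)
  y ⋖? x = (y <? x) ×-dec map′ (λ h z y<z z<x → h z (y<z , z<x)) (λ h z (y<z , z<x) → h z y<z z<x)
                                  (all? (λ z → ¬? ((y <? z) ×-dec (z <? x))))

  isMinimal? : ∀ y → Dec (IsMinimal y)
  isMinimal? y = all? (λ z → (z ≤? y) →-dec (z ≟ y))

  inM? : ∀ x → Dec (InM x)
  inM? x = all? (λ y → (y ⋖? x) →-dec isMinimal? y)

  ⋖*⇒≤ : ∀ {x y} → Star _⋖_ x y → x ≤P y
  ⋖*⇒≤ {x} ε        = ≤-refl x
  ⋖*⇒≤ (y⋖z ◅ y⋖*z) = ≤-trans (proj₁ (proj₁ y⋖z)) (⋖*⇒≤ y⋖*z)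

  private
    interval : Fin n → Fin n → Fin n → Bool
    interval x y e = does ((x ≤? e) ×-dec (e ≤? y))

    interval-shrinks : ∀ {x y z} → x ≤P y → x <P z → z <P y →
                       size (interval x z) ℕ.< size (interval x y) × size (interval z y) ℕ.< size (interval x y)
    interval-shrinks {x} {y} {z} x≤y (x≤z , x≢z) (z≤y , z≢y) =
      size-< (λ e x≤e≤z → let (x≤e , e≤z) = does-true⇒ ((x ≤? e) ×-dec (e ≤? z)) x≤e≤z in
                          dec-true ((x ≤? e) ×-dec (e ≤? y)) (x≤e , ≤-trans e≤z z≤y))
             y (dec-true ((x ≤? y) ×-dec (y ≤? y)) (x≤y , ≤-refl y))
             (dec-false ((x ≤? y) ×-dec (y ≤? z)) (λ (_ , y≤z) → z≢y (≤-antisym z y z≤y y≤z)))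
      , size-< (λ e z≤e≤y → let (z≤e , e≤y) = does-true⇒ ((z ≤? e) ×-dec (e ≤? y)) z≤e≤y in
                            dec-true ((x ≤? e) ×-dec (e ≤? y)) (≤-trans x≤z z≤e , e≤y))
               x (dec-true ((x ≤? x) ×-dec (x ≤? y)) (≤-refl x , x≤y))
               (dec-false ((z ≤? x) ×-dec (x ≤? y)) (λ (z≤x , _) → x≢z (≤-antisym x z x≤z z≤x)))

    ≤⇒⋖*-bounded : ∀ k x y → size (interval x y) ℕ.< k → x ≤P y → Star _⋖_ x y
    ≤⇒⋖*-bounded (suc k) x y bound x≤y with x ≟ y
    ... | yes refl = ε
    ... | no x≢y with any? (λ z → (x <? z) ×-dec (z <? y))
    ... | no no-between = ((x≤y , x≢y) , λ z x<z z<y → no-between (z , x<z , z<y)) ◅ ε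
    ... | yes (z , x<z , z<y) =
      ≤⇒⋖*-bounded k x z (ℕP.<-≤-trans (proj₁ shrinks) (ℕP.≤-pred bound)) (proj₁ x<z) ◅◅
      ≤⇒⋖*-bounded k z y (ℕP.<-≤-trans (proj₂ shrinks) (ℕP.≤-pred bound)) (proj₁ z<y)
      where shrinks = interval-shrinks x≤y x<z z<y

  ≤⇒⋖* : ∀ {x y} → x ≤P y → Star _⋖_ x y
  ≤⇒⋖* {x} {y} = ≤⇒⋖*-bounded (suc (size (interval x y))) x y (ℕP.n<1+n _)

  <M⇒⋖ : ∀ {y z} → InM y → z <P y → z ⋖ y × IsMinimal z
  <M⇒⋖ {y} {z} y∈M (z≤y , z≢y) with last-step (≤⇒⋖* z≤y) z≢y
  ... | w , z⋖*w , w⋖y with y∈M w w⋖y z (⋖*⇒≤ z⋖*w)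
  ... | refl = w⋖y , y∈M w w⋖y

  minimal⇒M : ∀ {y} → IsMinimal y → InM y
  minimal⇒M y-min z ((z≤y , z≢y) , _) = ⊥-elim (z≢y (y-min z z≤y))

  ⋖M⇒M : ∀ {x y} → InM x → y ⋖ x → InM y
  ⋖M⇒M x∈M y⋖x = minimal⇒M (x∈M _ y⋖x)

  ⋖⇒⋖M : ∀ {x y} → InM x → InM y → x ⋖ y → x ⋖M y
  ⋖⇒⋖M x∈M y∈M (x<y , nothing-between) = x∈M , y∈M , x<y , λ z _ → nothing-between z

  HasseAdj⇒HasseAdjM : ∀ {x y} → InM x → InM y → HasseAdj x y → HasseAdjM x y
  HasseAdj⇒HasseAdjM x∈M y∈M (inj₁ x⋖y) = inj₁ (⋖⇒⋖M x∈M y∈M x⋖y)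
  HasseAdj⇒HasseAdjM x∈M y∈M (inj₂ y⋖x) = inj₂ (⋖⇒⋖M y∈M x∈M y⋖x)

  HasseAdj-sym : ∀ {x y} → HasseAdj x y → HasseAdj y x
  HasseAdj-sym (inj₁ x⋖y) = inj₂ x⋖y
  HasseAdj-sym (inj₂ y⋖x) = inj₁ y⋖x

  HasseIn : (Fin n → Bool) → Fin n → Fin n → Set
  HasseIn S = Graph.AdjIn HasseAdj (λ z → S z ≡ true)

  HasseIn-sym : ∀ {S x y} → HasseIn S x y → HasseIn S y x
  HasseIn-sym (Sx , Sy , x—y) = Sy , Sx , HasseAdj-sym x—y

  ConnectedIn : (Fin n → Bool) → Set
  ConnectedIn S = ∀ x y → S x ≡ true → S y ≡ true → Star (HasseIn S) x y

module _ {n : ℕ} (P : FinPoset n) where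
  open PosetNotions P
  open PosetFacts P
  open Walks

  -- Two lower covers of b ∈ M_P joined inside M_P ∖ {b} would close a cycle through b.
  lower-covers-disconnected : MAcyclic → ∀ (S : Fin n → Bool) {a a′ b} →
    (∀ z → S z ≡ true → InM z) → InM b → S b ≡ false → a ⋖ b → a′ ⋖ b → a ≢ a′ →
    ¬ Star (HasseIn S) a a′
  lower-covers-disconnected acyclic S {a} {a′} {b} S⊆M b∈M Sb a⋖b a′⋖b a≢a′ a—*a′
    with Star⇒Path _≟_ a—*a′
  ... | zero  , [] , _ = a≢a′ refl
  ... | suc j , e ∷ w , is-path = acyclic (record
        { j = j ; vtx = vtx ; inS = vtx∈M ; distinct = distinct ; step = step ; close = close })
    where
    on-path : ∀ i → S (vertex (e ∷ w) i) ≡ true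
    on-path = vertex-all (λ z → S z ≡ true) (λ (_ , Sz , _) → Sz) (e ∷ w) (proj₁ e)
    vtx : Fin (3 ℕ.+ j) → Fin n
    vtx zero    = b
    vtx (suc i) = vertex (e ∷ w) i
    vtx∈M : ∀ i → InM (vtx i)
    vtx∈M zero    = b∈M
    vtx∈M (suc i) = S⊆M _ (on-path i)
    b∉path : ∀ i → b ≢ vertex (e ∷ w) i
    b∉path i b≡v = true≢false (trans (sym (on-path i)) (trans (cong S (sym b≡v)) Sb))
    distinct : ∀ i i′ → vtx i ≡ vtx i′ → i ≡ i′
    distinct zero    zero     _  = refl
    distinct zero    (suc i′) eq = ⊥-elim (b∉path i′ eq)
    distinct (suc i) zero     eq = ⊥-elim (b∉path i (sym eq))
    distinct (suc i) (suc i′) eq = cong suc (is-path i i′ eq)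
    step : ∀ (i : Fin (2 ℕ.+ j)) → HasseAdjM (vtx (inject₁ i)) (vtx (suc i))
    step zero    = inj₂ (⋖⇒⋖M (⋖M⇒M b∈M a⋖b) b∈M a⋖b)
    step (suc i) with vertex-step (e ∷ w) i
    ... | Su , Sv , u—v = HasseAdj⇒HasseAdjM (S⊆M _ Su) (S⊆M _ Sv) u—v
    close : HasseAdjM (vtx (fromℕ (2 ℕ.+ j))) (vtx zero)
    close = subst (λ z → HasseAdjM z b) (sym (vertex-last (e ∷ w)))
                  (inj₁ (⋖⇒⋖M (⋖M⇒M b∈M a′⋖b) b∈M a′⋖b))

-- Over a lower-cover-closed subtree S of the forest M_P, counting lower covers counts the edges of S,
-- so the sum over S of ω = (number of lower covers − 1) is #edges − #vertices = −1.
module Subtrees {n : ℕ} (P : FinPoset n) (acyclic : PosetNotions.MAcyclic P) where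
  open PosetNotions P
  open PosetFacts P

  down-degree : Fin n → ℤ
  down-degree x = sumℤ (λ y → 𝟙 (does (y ⋖? x)))

  ω : Fin n → ℤ
  ω x = down-degree x - 1ℤ

  weight : (Fin n → Bool) → ℤ
  weight S = sumℤ (λ x → 𝟙 (S x) * ω x)

  LowerCoverClosed : (Fin n → Bool) → Set
  LowerCoverClosed S = ∀ x y → S x ≡ true → y ⋖ x → S y ≡ true

  record IsLowerSubtree (S : Fin n → Bool) : Set where
    field
      ⊆M        : ∀ x → S x ≡ true → InM x
      closed    : LowerCoverClosed S
      nonempty  : ∃ λ x → S x ≡ true
      connected : ConnectedIn S

  _─_ : (Fin n → Bool) → Fin n → Fin n → Bool
  (S ─ b) x = S x ∧ not (does (b ≟ x))

  leaf-weight : ∀ {S} → IsLowerSubtree S → (∀ b → S b ≡ true → ∀ a → ¬ a ⋖ b) → weight S ≡ -1ℤ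
  leaf-weight {S} sub no-covers = begin
    sumℤ (λ x → 𝟙 (S x) * ω x)  ≡⟨ sumℤ-cong (λ x → cong (_* ω x) (S≡δs x)) ⟩
    sumℤ (λ x → δ s x * ω x)    ≡⟨ sumℤ-δ s ω ⟩
    down-degree s - 1ℤ
      ≡⟨ cong (_- 1ℤ) (sumℤ-zero _ (λ y → cong 𝟙 (dec-false (y ⋖? s) (no-covers s Ss y)))) ⟩
    -1ℤ                         ∎
    where
    open ≡-Reasoning
    open IsLowerSubtree sub
    s = proj₁ nonempty
    Ss = proj₂ nonempty
    only-s : ∀ x → S x ≡ true → s ≡ x
    only-s x Sx with connected s x Ss Sx
    ... | ε = refl
    ... | (_ , Sz , inj₁ s⋖z) ◅ _ = ⊥-elim (no-covers _ Sz s s⋖z)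
    ... | (_ , _  , inj₂ z⋖s) ◅ _ = ⊥-elim (no-covers s Ss _ z⋖s)
    S≡δs : ∀ x → 𝟙 (S x) ≡ δ s x
    S≡δs x with S x in Sx | s ≟ x
    ... | true  | yes _    = refl
    ... | true  | no s≢x   = ⊥-elim (s≢x (only-s x Sx))
    ... | false | yes refl = ⊥-elim (true≢false (trans (sym Ss) Sx))
    ... | false | no _     = refl

  -- Removing a vertex b with lower covers splits a subtree into one subtree per lower cover of b.
  module Split {S : Fin n → Bool} (sub : IsLowerSubtree S) {b a₀ : Fin n} (Sb : S b ≡ true) (a₀⋖b : a₀ ⋖ b)
               (reach? : ∀ a x → Dec (Star (HasseIn (S ─ b)) a x))
               (ih : ∀ {S′} → size S′ ℕ.< size S → IsLowerSubtree S′ → weight S′ ≡ -1ℤ) where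
    open IsLowerSubtree sub

    private
      ─-⊆ : ∀ {x} → (S ─ b) x ≡ true → S x ≡ true
      ─-⊆ {x} = ∧-conicalˡ (S x) _

      ─-self : (S ─ b) b ≡ false
      ─-self rewrite dec-true (b ≟ b) refl = ∧-zeroʳ (S b)

      ─-≢ : ∀ {x} → (S ─ b) x ≡ true → b ≢ x
      ─-≢ S─bx refl = true≢false (trans (sym S─bx) ─-self)

      ─-intro : ∀ {x} → S x ≡ true → b ≢ x → (S ─ b) x ≡ true
      ─-intro {x} Sx b≢x rewrite Sx | dec-false (b ≟ x) b≢x = refl

    component : Fin n → Fin n → Bool
    component a x = (S ─ b) x ∧ does (reach? a x)

    private
      component⇒─ : ∀ {a x} → component a x ≡ true → (S ─ b) x ≡ true
      component⇒─ = ∧-conicalˡ _ _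

      component⇒reach : ∀ {a x} → component a x ≡ true → Star (HasseIn (S ─ b)) a x
      component⇒reach {a} {x} = does-true⇒ (reach? a x) ∘ ∧-conicalʳ _ _

      reach⇒component : ∀ {a x} → (S ─ b) x ≡ true → Star (HasseIn (S ─ b)) a x → component a x ≡ true
      reach⇒component {a} {x} S─bx a—*x rewrite S─bx = dec-true (reach? a x) a—*x

      b∈M : InM b
      b∈M = ⊆M b Sb

      b-not-minimal : ¬ IsMinimal b
      b-not-minimal b-min = proj₂ (proj₁ a₀⋖b) (b-min a₀ (proj₁ (proj₁ a₀⋖b)))

      within : ∀ {a x} → Star (HasseIn (S ─ b)) a x → Star (HasseIn (component a)) a x
      within = AdjIn-restrict (λ a—*z S─bz → reach⇒component S─bz a—*z)

    component-subtree : ∀ {a} → a ⋖ b → IsLowerSubtree (component a)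
    component-subtree {a} a⋖b = record
      { ⊆M        = λ x → ⊆M x ∘ ─-⊆ ∘ component⇒─
      ; closed    = closed′
      ; nonempty  = a , reach⇒component (─-intro (closed b a Sb a⋖b) (λ b≡a → proj₂ (proj₁ a⋖b) (sym b≡a))) ε
      ; connected = λ x y cx cy →
          reverse HasseIn-sym (within (component⇒reach cx)) ◅◅ within (component⇒reach cy)
      }
      where
      closed′ : LowerCoverClosed (component a)
      closed′ x y cx y⋖x =
        reach⇒component S─by (component⇒reach cx ◅◅ ((component⇒─ cx , S─by , inj₂ y⋖x) ◅ ε))
        where
        -- y is minimal since x ∈ M_P, while b is not
        S─by : (S ─ b) y ≡ true
        S─by = ─-intro (closed x y (─-⊆ (component⇒─ cx)) y⋖x)
                       (λ { refl → b-not-minimal (⊆M x (─-⊆ (component⇒─ cx)) y y⋖x) })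

    component-weight : ∀ {a} → a ⋖ b → weight (component a) ≡ -1ℤ
    component-weight {a} a⋖b =
      ih (size-< (λ _ → ─-⊆ ∘ component⇒─) b Sb (cong (_∧ does (reach? a b)) ─-self))
         (component-subtree a⋖b)

    private
      Hanging : Fin n → Set
      Hanging z = z ≡ b ⊎ ((S ─ b) z ≡ true × ∃ λ a → a ⋖ b × Star (HasseIn (S ─ b)) a z)

      hanging-step : ∀ {z z′} → Hanging z → HasseIn S z z′ → Hanging z′
      hanging-step {z′ = z′} = step (b ≟ z′)
        where
        step : ∀ {z z′} → Dec (b ≡ z′) → Hanging z → HasseIn S z z′ → Hanging z′
        step (yes b≡z′) _ _ = inj₁ (sym b≡z′)
        step {z′ = z′} (no _) (inj₁ refl) (_ , Sz′ , inj₁ b⋖z′) =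
          ⊥-elim (b-not-minimal (⊆M z′ Sz′ b b⋖z′))
        step {z′ = z′} (no b≢z′) (inj₁ refl) (_ , Sz′ , inj₂ z′⋖b) =
          inj₂ (─-intro Sz′ b≢z′ , z′ , z′⋖b , ε)
        step (no b≢z′) (inj₂ (S─bz , a , a⋖b , a—*z)) (_ , Sz′ , z—z′) =
          inj₂ (─-intro Sz′ b≢z′ , a , a⋖b , a—*z ◅◅ ((S─bz , ─-intro Sz′ b≢z′ , z—z′) ◅ ε))

      hanging : ∀ {z y} → Hanging z → Star (HasseIn S) z y → Hanging y
      hanging h ε        = h
      hanging h (e ◅ es) = hanging (hanging-step h e) es

    covering : ∀ x → (S ─ b) x ≡ true → ∃ λ a → a ⋖ b × component a x ≡ true
    covering x S─bx with hanging (inj₁ refl) (connected b x Sb (─-⊆ S─bx))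
    ... | inj₁ refl = ⊥-elim (─-≢ S─bx refl)
    ... | inj₂ (_ , a , a⋖b , a—*x) = a , a⋖b , reach⇒component S─bx a—*x

    unique : ∀ {a a′ x} → a ⋖ b → a′ ⋖ b → component a x ≡ true → component a′ x ≡ true → a ≡ a′
    unique {a} {a′} a⋖b a′⋖b cx c′x with a ≟ a′
    ... | yes a≡a′ = a≡a′
    ... | no  a≢a′ = ⊥-elim (lower-covers-disconnected P acyclic (S ─ b) (λ z → ⊆M z ∘ ─-⊆) b∈M ─-self
                               a⋖b a′⋖b a≢a′
                               (component⇒reach cx ◅◅ reverse HasseIn-sym (component⇒reach c′x)))

    cover-count : Fin n → Fin n → ℤ
    cover-count x a = 𝟙 (does (a ⋖? b)) * 𝟙 (component a x)

    private
      outside-uncovered : ∀ {x} → (S ─ b) x ≡ false → sumℤ (cover-count x) ≡ 0ℤ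
      outside-uncovered {x} S─bx = sumℤ-zero (cover-count x) λ a →
        trans (cong (λ c → 𝟙 (does (a ⋖? b)) * 𝟙 (c ∧ does (reach? a x))) S─bx)
              (ℤP.*-zeroʳ (𝟙 (does (a ⋖? b))))

      inside-covered-once : ∀ {x} → (S ─ b) x ≡ true → sumℤ (cover-count x) ≡ 1ℤ
      inside-covered-once {x} S─bx = trans (sumℤ-cong single) (sumℤ-δ a₁ (λ _ → 1ℤ))
        where
        a₁-spec = covering x S─bx
        a₁ = proj₁ a₁-spec
        a₁⋖b = proj₁ (proj₂ a₁-spec)
        ca₁x = proj₂ (proj₂ a₁-spec)
        single : ∀ a → cover-count x a ≡ δ a₁ a * 1ℤ
        single a with a₁ ≟ a
        ... | yes refl = cong₂ (λ u v → 𝟙 u * 𝟙 v) (dec-true (a₁ ⋖? b) a₁⋖b) ca₁x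
        ... | no a₁≢a  = absent (a ⋖? b)
          where
          absent : (a⋖?b : Dec (a ⋖ b)) → 𝟙 (does a⋖?b) * 𝟙 (component a x) ≡ 0ℤ
          absent (no _) = refl
          absent (yes a⋖b) with component a x in cax
          ... | true  = ⊥-elim (a₁≢a (unique a₁⋖b a⋖b ca₁x cax))
          ... | false = refl

    partition : ∀ x → 𝟙 (S x) ≡ δ b x + sumℤ (cover-count x)
    partition x = by-cases (b ≟ x) (S x) refl
      where
      by-cases : Dec (b ≡ x) → ∀ s → S x ≡ s → 𝟙 (S x) ≡ δ b x + sumℤ (cover-count x)
      by-cases (yes b≡x) _ _ = begin
        𝟙 (S x)                        ≡⟨ cong 𝟙 (subst (λ z → S z ≡ true) b≡x Sb) ⟩
        1ℤ + 0ℤ                        ≡⟨ cong₂ _+_ (sym (δ-≡ b≡x))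
                                       (sym (outside-uncovered (subst (λ z → (S ─ b) z ≡ false) b≡x ─-self))) ⟩
        δ b x + sumℤ (cover-count x)   ∎
        where open ≡-Reasoning
      by-cases (no b≢x) false Sx = begin
        𝟙 (S x)                        ≡⟨ cong 𝟙 Sx ⟩
        0ℤ + 0ℤ                        ≡⟨ cong₂ _+_ (sym (δ-≢ b≢x))
                                                    (sym (outside-uncovered (cong (_∧ _) Sx))) ⟩
        δ b x + sumℤ (cover-count x)   ∎
        where open ≡-Reasoning
      by-cases (no b≢x) true Sx = begin
        𝟙 (S x)                        ≡⟨ cong 𝟙 Sx ⟩
        0ℤ + 1ℤ                        ≡⟨ cong₂ _+_ (sym (δ-≢ b≢x))
                                                    (sym (inside-covered-once (─-intro Sx b≢x))) ⟩
        δ b x + sumℤ (cover-count x)   ∎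
        where open ≡-Reasoning

    weight≡-1 : weight S ≡ -1ℤ
    weight≡-1 = begin
      sumℤ (λ x → 𝟙 (S x) * ω x)
        ≡⟨ sumℤ-cong (λ x → trans (cong (_* ω x) (partition x)) (ℤP.*-distribʳ-+ (ω x) (δ b x) _)) ⟩
      sumℤ (λ x → δ b x * ω x + sumℤ (cover-count x) * ω x)
        ≡⟨ sumℤ-+ (λ x → δ b x * ω x) (λ x → sumℤ (cover-count x) * ω x) ⟩
      sumℤ (λ x → δ b x * ω x) + sumℤ (λ x → sumℤ (cover-count x) * ω x)
        ≡⟨ cong₂ _+_ (sumℤ-δ b ω) (sumℤ-cong (λ x → sym (sumℤ-*ʳ (ω x) (cover-count x)))) ⟩
      ω b + sumℤ (λ x → sumℤ (λ a → cover-count x a * ω x))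
        ≡⟨ cong (_+_ (ω b)) (sumℤ-swap (λ x a → cover-count x a * ω x)) ⟩
      ω b + sumℤ (λ a → sumℤ (λ x → cover-count x a * ω x))
        ≡⟨ cong (_+_ (ω b)) (sumℤ-cong per-cover) ⟩
      ω b + sumℤ (λ a → 𝟙 (does (a ⋖? b)) * -1ℤ)
        ≡⟨ cong (_+_ (ω b)) (trans (sumℤ-*ʳ -1ℤ (λ a → 𝟙 (does (a ⋖? b))))
                                   (ℤP.*-comm (down-degree b) -1ℤ)) ⟩
      ω b + -1ℤ * down-degree b
        ≡⟨ cong (_+_ (ω b)) (ℤP.-1*i≡-i (down-degree b)) ⟩
      (down-degree b - 1ℤ) - down-degree b
        ≡⟨ cancel (down-degree b) ⟩
      -1ℤ ∎
      where
      open ≡-Reasoning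
      cancel : ∀ d → (d - 1ℤ) - d ≡ -1ℤ
      cancel = solve-∀
      per-cover : ∀ a → sumℤ (λ x → cover-count x a * ω x) ≡ 𝟙 (does (a ⋖? b)) * -1ℤ
      per-cover a = begin
        sumℤ (λ x → 𝟙 (does (a ⋖? b)) * 𝟙 (component a x) * ω x)
          ≡⟨ sumℤ-cong (λ x → ℤP.*-assoc (𝟙 (does (a ⋖? b))) (𝟙 (component a x)) (ω x)) ⟩
        sumℤ (λ x → 𝟙 (does (a ⋖? b)) * (𝟙 (component a x) * ω x))
          ≡⟨ sumℤ-*ˡ (𝟙 (does (a ⋖? b))) (λ x → 𝟙 (component a x) * ω x) ⟩
        𝟙 (does (a ⋖? b)) * weight (component a)
          ≡⟨ by-cases (a ⋖? b) ⟩
        𝟙 (does (a ⋖? b)) * -1ℤ ∎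
        where
        by-cases : (a⋖?b : Dec (a ⋖ b)) → 𝟙 (does a⋖?b) * weight (component a) ≡ 𝟙 (does a⋖?b) * -1ℤ
        by-cases (yes a⋖b) = cong (_*_ 1ℤ) (component-weight a⋖b)
        by-cases (no _)    = refl

  lower-subtree-weight : ∀ {S} → IsLowerSubtree S → weight S ≡ -1ℤ
  lower-subtree-weight {S} = bounded (suc (size S)) (ℕP.n<1+n _)
    where
    bounded : ∀ k {S} → size S ℕ.< k → IsLowerSubtree S → weight S ≡ -1ℤ
    bounded (suc k) {S} bound sub with any? (λ b → (S b ≟ᵇ true) ×-dec any? (λ a → a ⋖? b))
    ... | no no-covers = leaf-weight sub (λ b Sb a a⋖b → no-covers (b , Sb , a , a⋖b))
    ... | yes (b , Sb , a , a⋖b) =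
      -- reachability in a finite graph is decidable; deciding it under ¬¬ suffices as the goal is
      -- a decidable equation
      decidable-stable (weight S ℤ.≟ -1ℤ)
        (¬¬-map (λ reach? → Split.weight≡-1 sub Sb a⋖b reach?
                              (λ smaller → bounded k (ℕP.<-≤-trans smaller (ℕP.≤-pred bound))))
                (¬¬-Π-Fin (λ _ → ¬¬-decide)))

module _ {n : ℕ} (P : FinPoset n) where
  open PosetNotions P
  open PosetFacts P
  open Graph HasseAdj using (AdjIn; ReachIn)

  -- By the cc condition, sending a component of C ∩ M_P to the component of M_P containing it is a
  -- surjection between two sets of the same finite size, hence injective.
  cc⇒components-connected : CCCondition → ∀ {C} → IsConnectedDownset C →
    ∀ {x y} → x ∈ C → y ∈ C → InM x → InM y → SameCompM x y → ReachIn (λ z → z ∈ C × InM z) x y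
  cc⇒components-connected cc {C} C-conn {x} {y} x∈C y∈C x∈M y∈M x—*y =
    Equivalence.to (f-iff x y (x∈C , x∈M) (y∈C , y∈M))
      (Fin-surjective⇒injective h h-surj _ _
        (trans (h∘f (x∈C , x∈M)) (trans (Equivalence.from (g-iff x y _ _) (meeting-path x—*y y∈C y∈M))
                                          (sym (h∘f (y∈C , y∈M))))))
    where
    C∩M : Fin n → Set
    C∩M z = z ∈ C × InM z
    k = proj₁ (cc C C-conn)
    g = proj₁ (proj₁ (proj₂ (cc C C-conn)))
    g-iff = proj₁ (proj₂ (proj₁ (proj₂ (cc C C-conn))))
    g-surj = proj₂ (proj₂ (proj₁ (proj₂ (cc C C-conn))))
    f = proj₁ (proj₂ (proj₂ (cc C C-conn)))
    f-iff = proj₁ (proj₂ (proj₂ (proj₂ (cc C C-conn))))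
    f-surj = proj₂ (proj₂ (proj₂ (proj₂ (cc C C-conn))))

    meeting : ∀ {z} → C∩M z → CompsMeeting C z
    meeting (z∈C , z∈M) = z∈M , _ , z∈C , z∈M , ε

    meeting-path : ∀ {y c} → SameCompM y c → c ∈ C → InM c → GM.ReachIn (CompsMeeting C) y c
    meeting-path ε _ _ = ε
    meeting-path (e@(y∈M , z∈M , y—z) ◅ es) c∈C c∈M =
      ((y∈M , _ , c∈C , c∈M , e ◅ es) , (z∈M , _ , c∈C , c∈M , es) , y—z) ◅ meeting-path es c∈C c∈M

    C∩M-path⇒meeting-path : ∀ {x y} → ReachIn C∩M x y → GM.ReachIn (CompsMeeting C) x y
    C∩M-path⇒meeting-path = Star.map λ (u , v , u—v) →
      meeting u , meeting v , HasseAdj⇒HasseAdjM (proj₂ u) (proj₂ v) u—v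

    h : Fin k → Fin k
    h i = g _ (meeting (proj₁ (proj₂ (f-surj i))))

    h∘f : ∀ {x} (x∈C∩M : C∩M x) → h (f x x∈C∩M) ≡ g x (meeting x∈C∩M)
    h∘f {x} x∈C∩M = Equivalence.from (g-iff _ x _ _)
      (C∩M-path⇒meeting-path (Equivalence.to (f-iff _ x _ x∈C∩M) (proj₂ (proj₂ (f-surj (f x x∈C∩M))))))

    h-surj : ∀ j → ∃ λ i → h i ≡ j
    h-surj j with g-surj j
    ... | y , y∈meeting@(_ , c , c∈C , c∈M , y—*c) , gy≡j =
      f c (c∈C , c∈M) , trans (h∘f (c∈C , c∈M))
        (trans (sym (Equivalence.from (g-iff y c y∈meeting _) (meeting-path y—*c c∈C c∈M))) gy≡j)

module TreeQuotient {n : ℕ} (P : FinPoset n) (t : Fin n) (top : ∀ x → PosetNotions._≤P_ P x t)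
                    {m : ℕ} (q : Fin n → Fin m) (tree-quotient : PosetNotions.IsTreeQuotient P q) where
  open PosetNotions P
  open PosetFacts P

  rep : Fin m → Fin n
  rep X = proj₁ (proj₁ tree-quotient X)

  q-rep : ∀ X → q (rep X) ≡ X
  q-rep X = proj₂ (proj₁ tree-quotient X)

  ≡⇒∼ : ∀ {x y} → q x ≡ q y → x ∼ y
  ≡⇒∼ {x} {y} = Equivalence.to (proj₂ tree-quotient x y)

  ∼⇒≡ : ∀ {x y} → x ∼ y → q x ≡ q y
  ∼⇒≡ {x} {y} = Equivalence.from (proj₂ tree-quotient x y)

  _≤Q_ : Fin m → Fin m → Set
  _≤Q_ = QuotLe q

  ≤⇒≤Q : ∀ {x y} → x ≤P y → q x ≤Q q y
  ≤⇒≤Q {x} {y} x≤y = x , y , refl , refl , x≤y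

  module ConeP = TopCone _≤P_ t top
  module ConeQ = TopCone _≤Q_ (q t) (λ X → subst (_≤Q q t) (q-rep X) (≤⇒≤Q (top (rep X))))

  class-of-M : ∀ {x y} → InM y → q x ≡ q y → InM x
  class-of-M y∈M qx≡qy with ≡⇒∼ qx≡qy
  ... | inj₁ refl         = y∈M
  ... | inj₂ (x∈M , _ , _) = x∈M

  class-of-M-rep : ∀ {x X} → InM (rep X) → q x ≡ X → InM x
  class-of-M-rep {X = X} repX∈M qx≡X = class-of-M repX∈M (trans qx≡X (sym (q-rep X)))

  below-M-same-class : ∀ {y z} → InM z → y ≤P z → q y ≡ q z
  below-M-same-class {y} {z} z∈M y≤z with y ≟ z
  ... | yes refl = refl
  ... | no  y≢z  = ∼⇒≡ (inj₂ (y∈M , z∈M , (y∈M , z∈M , inj₁ (⋖⇒⋖M y∈M z∈M y⋖z)) ◅ ε))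
    where
    y⋖z = proj₁ (<M⇒⋖ z∈M (y≤z , y≢z))
    y∈M = ⋖M⇒M z∈M y⋖z

  -- A class is a single point or a connected component of M_P.
  class-constant : ∀ (F : Fin n → Bool) {x y} → q x ≡ q y →
    (∀ z z′ → z ≤P z′ → q z ≡ q x → q z′ ≡ q x → F z ≡ F z′) → F x ≡ F y
  class-constant F {x} qx≡qy constant with ≡⇒∼ qx≡qy
  ... | inj₁ refl = refl
  ... | inj₂ (x∈M , _ , x—*y) = along ε x—*y
    where
    along : ∀ {z y} → SameCompM x z → SameCompM z y → F z ≡ F y
    along x—*z ε = refl
    along {z} x—*z (e@(z∈M , z′∈M , z—z′) ◅ es) = trans (step z—z′) (along x—*z′ es)
      where
      x—*z′ = x—*z ◅◅ (e ◅ ε)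
      qz≡qx = sym (∼⇒≡ (inj₂ (x∈M , z∈M , x—*z)))
      qz′≡qx = sym (∼⇒≡ (inj₂ (x∈M , z′∈M , x—*z′)))
      step : HasseAdjM z _ → F z ≡ F _
      step (inj₁ z⋖z′) = constant _ _ (proj₁ (proj₁ (proj₂ (proj₂ z⋖z′)))) qz≡qx qz′≡qx
      step (inj₂ z′⋖z) = sym (constant _ _ (proj₁ (proj₁ (proj₂ (proj₂ z′⋖z)))) qz′≡qx qz≡qx)

  cut-pullback : ∀ {V} → ConeQ.IsCut V → ConeP.IsCut (V ∘ q)
  cut-pullback {V} cut = record
    { upset     = λ x y x≤y → upset (q x) (q y) (≤⇒≤Q x≤y)
    ; top∈      = top∈
    ; outside   = rep (proj₁ outside) , trans (cong V (q-rep (proj₁ outside))) (proj₂ outside)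
    ; connected = connected′
    }
    where
    open ConeQ.IsCut cut
    connected′ : ConeP.IsConnected (not ∘ V ∘ q)
    connected′ T constant (x₁ , ¬Vqx₁ , Tx₁) x ¬Vqx =
      trans (T-rep x ¬Vqx)
            (connected (T ∘ rep) constantQ (q x₁ , ¬Vqx₁ , trans (sym (T-rep x₁ ¬Vqx₁)) Tx₁) (q x) ¬Vqx)
      where
      T-rep : ∀ x → not (V (q x)) ≡ true → T x ≡ T (rep (q x))
      T-rep x ¬Vqx = class-constant T (sym (q-rep (q x))) λ z z′ z≤z′ qz≡qx qz′≡qx →
        constant z z′ z≤z′ (trans (cong (not ∘ V) qz≡qx) ¬Vqx) (trans (cong (not ∘ V) qz′≡qx) ¬Vqx)
      constantQ : ConeQ.ConstantOn (not ∘ V) (T ∘ rep)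
      constantQ _ _ (x , y , refl , refl , x≤y) ¬Vqx ¬Vqy =
        trans (sym (T-rep x ¬Vqx)) (trans (constant x y x≤y ¬Vqx ¬Vqy) (T-rep y ¬Vqy))

  pushforward : (Fin n → ℤ) → Fin m → ℤ
  pushforward w X = sumℤ (λ x → δ (q x) X * w x)

  pairing-pushforward : ∀ (w : Fin n → ℤ) (g : Fin m → ℤ) →
    pairing (pushforward w) g ≡ pairing w (g ∘ q)
  pairing-pushforward w g = begin
    sumℤ (λ X → sumℤ (λ x → δ (q x) X * w x) * g X)
      ≡⟨ sumℤ-cong (λ X → sym (sumℤ-*ʳ (g X) (λ x → δ (q x) X * w x))) ⟩
    sumℤ (λ X → sumℤ (λ x → δ (q x) X * w x * g X))
      ≡⟨ sumℤ-swap (λ X x → δ (q x) X * w x * g X) ⟩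
    sumℤ (λ x → sumℤ (λ X → δ (q x) X * w x * g X))
      ≡⟨ sumℤ-cong (λ x → sumℤ-cong (λ X → ℤP.*-assoc (δ (q x) X) (w x) (g X))) ⟩
    sumℤ (λ x → sumℤ (λ X → δ (q x) X * (w x * g X)))
      ≡⟨ sumℤ-cong (λ x → sumℤ-δ (q x) (λ X → w x * g X)) ⟩
    sumℤ (λ x → w x * g (q x)) ∎
    where open ≡-Reasoning

  sumℤ-pushforward : ∀ (w : Fin n → ℤ) → sumℤ (pushforward w) ≡ sumℤ w
  sumℤ-pushforward w = trans (sumℤ-swap (λ X x → δ (q x) X * w x))
                             (sumℤ-cong (λ x → sumℤ-δ (q x) (λ _ → w x)))

  cutWeight-pushforward : ∃ ConeP.CutWeight → ∃ ConeQ.CutWeight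
  cutWeight-pushforward (w , cut⇒-1) = pushforward w , λ V cut →
    trans (pairing-pushforward w (ConeQ.χ (not ∘ V))) (cut⇒-1 (V ∘ q) (cut-pullback cut))

module LiftedWeight {n : ℕ} (P : FinPoset n) (t : Fin n) (top : ∀ x → PosetNotions._≤P_ P x t)
                    (acyclic : PosetNotions.MAcyclic P) (cc : PosetNotions.CCCondition P)
                    {m : ℕ} (q : Fin n → Fin m) (tree-quotient : PosetNotions.IsTreeQuotient P q) where
  open PosetNotions P
  open PosetFacts P
  open Subtrees P acyclic
  open TreeQuotient P t top q tree-quotient

  module _ {D : Fin n → Bool} (D-down : ∀ {a z} → a ≤P z → D z ≡ true → D a ≡ true) where

    ≤⇒HasseIn : ∀ {a z} → a ≤P z → D z ≡ true → Star (HasseIn D) a z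
    ≤⇒HasseIn {z = z} a≤z Dz = go (≤⇒⋖* a≤z)
      where
      go : ∀ {a} → Star _⋖_ a z → Star (HasseIn D) a z
      go ε              = ε
      go (a⋖b ◅ b⋖*z) =
        (D-down (⋖*⇒≤ (a⋖b ◅ b⋖*z)) Dz , D-down (⋖*⇒≤ b⋖*z) Dz , inj₁ a⋖b) ◅ go b⋖*z

    ¬¬-ConnectedIn : ConeP.IsConnected D → ¬ ¬ ConnectedIn D
    ¬¬-ConnectedIn D-connected =
      ¬¬-map (λ reach? x y Dx Dy → from-x x (reach? x) y Dx Dy) (¬¬-Π-Fin (λ _ → ¬¬-decide))
      where
      from-x : ∀ x → (∀ y → Dec (Star (HasseIn D) x y)) →
               ∀ y → D x ≡ true → D y ≡ true → Star (HasseIn D) x y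
      from-x x reach? y Dx Dy =
        does-true⇒ (reach? y) (D-connected (λ z → does (reach? z)) constant (x , Dx , dec-true (reach? x) ε) y Dy)
        where
        constant : ConeP.ConstantOn D (λ z → does (reach? z))
        constant z z′ z≤z′ Dz Dz′ =
          does-⇔ (mk⇔ (_◅◅ ≤⇒HasseIn z≤z′ Dz′) (_◅◅ reverse HasseIn-sym (≤⇒HasseIn z≤z′ Dz′)))
                 (reach? z) (reach? z′)

    isConnectedDownset : (∃ λ x → D x ≡ true) → ConnectedIn D → IsConnectedDownset (tabulate D)
    isConnectedDownset (x₀ , Dx₀) D-conn =
        (x₀ , ∈-tabulate⁺ Dx₀)
      , (λ x y y∈ x≤y → ∈-tabulate⁺ (D-down x≤y (∈-tabulate⁻ y∈)))
      , (λ _ _ → zero)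
      , (λ x y x∈ y∈ → mk⇔ (λ _ → Star.map (λ (u , v , u—v) → ∈-tabulate⁺ u , ∈-tabulate⁺ v , u—v)
                                            (D-conn x y (∈-tabulate⁻ x∈) (∈-tabulate⁻ y∈)))
                           (λ _ → refl))
      , λ { zero → x₀ , ∈-tabulate⁺ Dx₀ , refl }

    -- This is where the cc condition enters.
    class∩-subtree : ∃ (λ x → D x ≡ true) → ConnectedIn D →
                     ∀ {X} → InM (rep X) → ∃ (λ x → D x ≡ true × q x ≡ X) →
                     IsLowerSubtree (λ x → does (q x ≟ X) ∧ D x)
    class∩-subtree D-ne D-conn {X} repX∈M (x₁ , Dx₁ , qx₁≡X) = record
      { ⊆M        = λ x → ⊆M′
      ; closed    = λ x y Kx y⋖x →
          K-intro (trans (below-M-same-class (⊆M′ Kx) (proj₁ (proj₁ y⋖x))) (in-class Kx))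
                  (D-down (proj₁ (proj₁ y⋖x)) (∧-conicalʳ _ _ Kx))
      ; nonempty  = x₁ , K-intro qx₁≡X Dx₁
      ; connected = connected
      }
      where
      K : Fin n → Bool
      K x = does (q x ≟ X) ∧ D x
      in-class : ∀ {x} → K x ≡ true → q x ≡ X
      in-class {x} Kx = does-true⇒ (q x ≟ X) (∧-conicalˡ _ _ Kx)
      ⊆M′ : ∀ {x} → K x ≡ true → InM x
      ⊆M′ Kx = class-of-M-rep repX∈M (in-class Kx)
      K-intro : ∀ {x} → q x ≡ X → D x ≡ true → K x ≡ true
      K-intro {x} qx≡X Dx rewrite dec-true (q x ≟ X) qx≡X = Dx
      connected : ConnectedIn K
      connected x y Kx Ky with ≡⇒∼ (trans (in-class Kx) (sym (in-class Ky)))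
      ... | inj₁ refl = ε
      ... | inj₂ (x∈M , y∈M , x—*y) =
        AdjIn-restrict (λ x—*z (z∈C , z∈M) →
                          K-intro (trans (sym (∼⇒≡ (inj₂ (x∈M , z∈M , M-path x—*z)))) (in-class Kx))
                                  (∈-tabulate⁻ z∈C))
          (cc⇒components-connected P cc (isConnectedDownset D-ne D-conn)
            (∈-tabulate⁺ (∧-conicalʳ _ _ Kx)) (∈-tabulate⁺ (∧-conicalʳ _ _ Ky)) x∈M y∈M x—*y)
        where
        M-path : ∀ {z} → Graph.ReachIn HasseAdj (λ z → z ∈ tabulate D × InM z) x z → SameCompM x z
        M-path = Star.map (λ ((_ , u∈M) , (_ , v∈M) , u—v) → u∈M , v∈M , HasseAdj⇒HasseAdjM u∈M v∈M u—v)

  module _ (w′ : Fin m → ℤ) (w′-cut : ConeQ.CutWeight w′) where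

    -- the class of an element of M_P is minimal in P/∼ and is not the top, so its complement is a cut
    w′-on-M-class : ¬ InM t → ∀ X → InM (rep X) → w′ X ≡ -1ℤ
    w′-on-M-class t∉M X repX∈M = begin
      w′ X                                ≡⟨ sym (sumℤ-δ X w′) ⟩
      sumℤ (λ Y → δ X Y * w′ Y)           ≡⟨ sumℤ-cong (λ Y → trans (ℤP.*-comm (δ X Y) (w′ Y))
                                                                   (cong (λ b → w′ Y * 𝟙 b) (sym (not-involutive _)))) ⟩
      pairing w′ (ConeQ.χ (not ∘ V))      ≡⟨ w′-cut V V-cut ⟩
      -1ℤ                                 ∎
      where
      open ≡-Reasoning
      V : Fin m → Bool
      V Y = not (does (X ≟ Y))
      V-intro : ∀ {Y} → X ≢ Y → V Y ≡ true
      V-intro {Y} X≢Y = cong not (dec-false (X ≟ Y) X≢Y)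
      V-cut : ConeQ.IsCut V
      V-cut = record
        { upset     = λ { _ _ (y , z , refl , refl , y≤z) Vqy → V-intro λ X≡qz →
                          true≢false (trans (sym Vqy) (cong not (dec-true (X ≟ q y)
                            (trans X≡qz (sym (below-M-same-class (class-of-M-rep repX∈M (sym X≡qz)) y≤z)))))) }
        ; top∈      = V-intro λ X≡qt → t∉M (class-of-M-rep repX∈M (sym X≡qt))
        ; outside   = X , cong not (dec-true (X ≟ X) refl)
        ; connected = λ T _ (Y₁ , ¬VY₁ , TY₁) Y ¬VY →
            subst (λ Z → T Z ≡ true) (trans (sym (the-point ¬VY₁)) (the-point ¬VY)) TY₁
        }
        where
        the-point : ∀ {Y} → not (V Y) ≡ true → X ≡ Y
        the-point {Y} ¬VY = does-true⇒ (X ≟ Y) (trans (sym (not-involutive _)) ¬VY)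

    lift : Fin n → ℤ
    lift x = if does (inM? x) then ω x else w′ (q x)

    lift-M : ∀ {x} → InM x → lift x ≡ ω x
    lift-M {x} x∈M rewrite dec-true (inM? x) x∈M = refl

    lift-non-M : ∀ {x} → ¬ InM x → lift x ≡ w′ (q x)
    lift-non-M {x} x∉M rewrite dec-false (inM? x) x∉M = refl

    module OnCut {U : Fin n → Bool} (cut : ConeP.IsCut U) where
      open ConeP.IsCut cut

      D : Fin n → Bool
      D = not ∘ U

      D-down : ∀ {a z} → a ≤P z → D z ≡ true → D a ≡ true
      D-down {a} {z} a≤z Dz with U a in Ua
      ... | true  = ⊥-elim (true≢false (trans (sym (upset a z a≤z Ua)) (not-injective Dz)))
      ... | false = refl

      D-t : D t ≡ false
      D-t = cong not top∈

      D-nonempty : ∃ λ x → D x ≡ true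
      D-nonempty = proj₁ outside , cong not (proj₂ outside)

      -- Then all of P lies in M_P, so D is itself a lower subtree.
      all-M : InM t → ConnectedIn D → pairing lift (ConeP.χ D) ≡ -1ℤ
      all-M t∈M D-conn = trans (sumℤ-cong (λ x → trans (cong (_* 𝟙 (D x)) (lift-M (everything-M x)))
                                                       (ℤP.*-comm (ω x) (𝟙 (D x)))))
                               (lower-subtree-weight (record
                                 { ⊆M        = λ x _ → everything-M x
                                 ; closed    = λ x y Dx y⋖x → D-down (proj₁ (proj₁ y⋖x)) Dx
                                 ; nonempty  = D-nonempty
                                 ; connected = D-conn
                                 }))
        where
        everything-M : ∀ x → InM x
        everything-M x with x ≟ t
        ... | yes refl = t∈M
        ... | no  x≢t  = minimal⇒M (proj₂ (<M⇒⋖ t∈M (top x , x≢t)))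

      module Image (t∉M : ¬ InM t) (D-conn : ConnectedIn D) where
        meets? : ∀ X → Dec (∃ λ x → D x ≡ true × q x ≡ X)
        meets? X = any? (λ x → (D x ≟ᵇ true) ×-dec (q x ≟ X))

        meets : Fin m → Bool
        meets X = does (meets? X)

        meets-intro : ∀ {x X} → D x ≡ true → q x ≡ X → meets X ≡ true
        meets-intro {x} {X} Dx qx≡X = dec-true (meets? X) (x , Dx , qx≡X)

        meets-down : ∀ {y z} → y ≤P z → meets (q z) ≡ true → meets (q y) ≡ true
        meets-down {y} {z} y≤z meets-qz with does-true⇒ (meets? (q z)) meets-qz
        ... | z₁ , Dz₁ , qz₁≡qz with ≡⇒∼ qz₁≡qz
        ...   | inj₁ refl          = meets-intro (D-down y≤z Dz₁) refl
        ...   | inj₂ (_ , z∈M , _) = meets-intro Dz₁ (trans qz₁≡qz (sym (below-M-same-class z∈M y≤z)))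

        image-cut : ConeQ.IsCut (not ∘ meets)
        image-cut = record
          { upset     = λ { _ _ (y , z , refl , refl , y≤z) ¬meets-qy → upset′ y≤z ¬meets-qy }
          ; top∈      = cong not top-outside
          ; outside   = q (proj₁ D-nonempty) , cong not (meets-intro (proj₂ D-nonempty) refl)
          ; connected = connected′
          }
          where
          upset′ : ∀ {y z} → y ≤P z → not (meets (q y)) ≡ true → not (meets (q z)) ≡ true
          upset′ {y} {z} y≤z ¬meets-qy with meets (q z) in meets-qz
          ... | true  = ⊥-elim (true≢false (trans (sym (meets-down y≤z meets-qz)) (not-injective ¬meets-qy)))
          ... | false = refl
          top-outside : meets (q t) ≡ false
          top-outside = dec-false (meets? (q t)) λ (x , Dx , qx≡qt) → case (≡⇒∼ qx≡qt) Dx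
            where
            case : ∀ {x} → x ∼ t → D x ≡ true → ⊥
            case (inj₁ refl)          Dt = true≢false (trans (sym Dt) D-t)
            case (inj₂ (_ , t∈M , _)) _  = t∉M t∈M
          meets⇒ : ∀ {Y} → not (not (meets Y)) ≡ true → ∃ λ x → D x ≡ true × q x ≡ Y
          meets⇒ {Y} m = does-true⇒ (meets? Y) (trans (sym (not-involutive _)) m)
          ⇒meets : ∀ {x} → D x ≡ true → not (not (meets (q x))) ≡ true
          ⇒meets Dx = trans (not-involutive _) (meets-intro Dx refl)
          connected′ : ConeQ.IsConnected (not ∘ not ∘ meets)
          connected′ T constant (Y₁ , meets-Y₁ , TY₁) Y meets-Y
            with meets⇒ meets-Y₁ | meets⇒ meets-Y
          ... | x₁ , Dx₁ , refl | x , Dx , refl =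
            connected (T ∘ q) (λ u v u≤v Du Dv → constant (q u) (q v) (≤⇒≤Q u≤v) (⇒meets Du) (⇒meets Dv))
                      (x₁ , Dx₁ , TY₁) x Dx

        private
          f : Fin n → ℤ
          f x = lift x * 𝟙 (D x)

          point-class : ∀ X → ¬ InM (rep X) → pushforward f X ≡ w′ X * 𝟙 (meets X)
          point-class X repX∉M = begin
            sumℤ (λ x → δ (q x) X * f x)
              ≡⟨ sumℤ-cong only-rep ⟩
            sumℤ (λ x → δ (rep X) x * f (rep X))
              ≡⟨ sumℤ-δ (rep X) (λ _ → f (rep X)) ⟩
            lift (rep X) * 𝟙 (D (rep X))
              ≡⟨ cong₂ (λ a b → a * 𝟙 b) (trans (lift-non-M repX∉M) (cong w′ (q-rep X))) D≡meets ⟩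
            w′ X * 𝟙 (meets X) ∎
            where
            open ≡-Reasoning
            class-is-rep : ∀ {x} → q x ≡ X → rep X ≡ x
            class-is-rep qx≡X with ≡⇒∼ (trans qx≡X (sym (q-rep X)))
            ... | inj₁ x≡rep            = sym x≡rep
            ... | inj₂ (_ , repX∈M , _) = ⊥-elim (repX∉M repX∈M)
            only-rep : ∀ x → δ (q x) X * f x ≡ δ (rep X) x * f (rep X)
            only-rep x = by-cases (rep X ≟ x)
              where
              by-cases : Dec (rep X ≡ x) → δ (q x) X * f x ≡ δ (rep X) x * f (rep X)
              by-cases (yes refl) = trans (cong (_* f x) (δ-≡ (q-rep X))) (sym (cong (_* f x) (δ-≡ {i = x} refl)))
              by-cases (no rep≢x) = begin
                δ (q x) X * f x         ≡⟨ cong (_* f x) (δ-≢ (rep≢x ∘ class-is-rep)) ⟩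
                0ℤ * f x                ≡⟨ ℤP.*-zeroˡ (f x) ⟩
                0ℤ                      ≡⟨ sym (ℤP.*-zeroˡ (f (rep X))) ⟩
                0ℤ * f (rep X)          ≡⟨ cong (_* f (rep X)) (sym (δ-≢ rep≢x)) ⟩
                δ (rep X) x * f (rep X) ∎
            D≡meets : D (rep X) ≡ meets X
            D≡meets with D (rep X) in D-rep
            ... | true  = sym (meets-intro D-rep (q-rep X))
            ... | false = sym (dec-false (meets? X) λ (x , Dx , qx≡X) →
                                true≢false (trans (sym Dx) (trans (cong D (sym (class-is-rep qx≡X))) D-rep)))

          M-class : ∀ X → InM (rep X) → pushforward f X ≡ w′ X * 𝟙 (meets X)
          M-class X repX∈M = trans (sumℤ-cong termwise) (by-meets (meets? X))
            where
            K : Fin n → Bool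
            K x = does (q x ≟ X) ∧ D x
            termwise : ∀ x → δ (q x) X * f x ≡ 𝟙 (K x) * ω x
            termwise x = by-cases (q x ≟ X)
              where
              by-cases : (qx≟X : Dec (q x ≡ X)) → 𝟙 (does qx≟X) * f x ≡ 𝟙 (does qx≟X ∧ D x) * ω x
              by-cases (yes qx≡X) = begin
                1ℤ * (lift x * 𝟙 (D x))  ≡⟨ ℤP.*-identityˡ _ ⟩
                lift x * 𝟙 (D x)         ≡⟨ cong (_* 𝟙 (D x)) (lift-M (class-of-M-rep repX∈M qx≡X)) ⟩
                ω x * 𝟙 (D x)            ≡⟨ ℤP.*-comm (ω x) (𝟙 (D x)) ⟩
                𝟙 (D x) * ω x            ∎
                where open ≡-Reasoning
              by-cases (no _) = trans (ℤP.*-zeroˡ (f x)) (sym (ℤP.*-zeroˡ (ω x)))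
            by-meets : (meets?X : Dec (∃ λ x → D x ≡ true × q x ≡ X)) → weight K ≡ w′ X * 𝟙 (does meets?X)
            by-meets (yes meets-X) =
              trans (lower-subtree-weight (class∩-subtree D-down D-nonempty D-conn repX∈M meets-X))
                    (sym (trans (ℤP.*-identityʳ (w′ X)) (w′-on-M-class t∉M X repX∈M)))
            by-meets (no misses-X) =
              trans (sumℤ-zero _ (λ x → by-cases x (q x ≟ X) (D x) refl)) (sym (ℤP.*-zeroʳ (w′ X)))
              where
              by-cases : ∀ x (qx≟X : Dec (q x ≡ X)) b → D x ≡ b → 𝟙 (does qx≟X ∧ b) * ω x ≡ 0ℤ
              by-cases x (no _)       _     _  = ℤP.*-zeroˡ (ω x)
              by-cases x (yes _)      false _  = ℤP.*-zeroˡ (ω x)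
              by-cases x (yes qx≡X) true  Dx = ⊥-elim (misses-X (x , Dx , qx≡X))

          class-sum : ∀ X → pushforward f X ≡ w′ X * 𝟙 (meets X)
          class-sum X with inM? (rep X)
          ... | yes repX∈M = M-class X repX∈M
          ... | no  repX∉M = point-class X repX∉M

        lift-weight : pairing lift (ConeP.χ D) ≡ -1ℤ
        lift-weight = begin
          sumℤ f                                   ≡⟨ sym (sumℤ-pushforward f) ⟩
          sumℤ (pushforward f)                     ≡⟨ sumℤ-cong class-sum ⟩
          sumℤ (λ X → w′ X * 𝟙 (meets X))
            ≡⟨ sumℤ-cong (λ X → cong (λ b → w′ X * 𝟙 b) (sym (not-involutive _))) ⟩
          pairing w′ (ConeQ.χ (not ∘ not ∘ meets)) ≡⟨ w′-cut (not ∘ meets) image-cut ⟩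
          -1ℤ                                      ∎
          where open ≡-Reasoning

      lift-on-cut : pairing lift (ConeP.χ D) ≡ -1ℤ
      lift-on-cut = decidable-stable (pairing lift (ConeP.χ D) ℤ.≟ -1ℤ)
                      (¬¬-map by-cases (¬¬-ConnectedIn D-down connected))
        where
        by-cases : ConnectedIn D → pairing lift (ConeP.χ D) ≡ -1ℤ
        by-cases D-conn with inM? t
        ... | yes t∈M = all-M t∈M D-conn
        ... | no  t∉M = Image.lift-weight t∉M D-conn

    lift-cutWeight : ConeP.CutWeight lift
    lift-cutWeight U cut = OnCut.lift-on-cut cut

  cutWeight-lift : ∃ ConeQ.CutWeight → ∃ ConeP.CutWeight
  cutWeight-lift (w′ , w′-cut) = lift w′ w′-cut , lift-cutWeight w′ w′-cut

lemma5p16 : (n : ℕ) (P : FinPoset n) → let open PosetNotions P in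
    2 ≤ n → HasseConnected → HasMaximum → MAcyclic → CCCondition →
    (m : ℕ) (q : Fin n → Fin m) → IsTreeQuotient q →
    IsGorenstein _≤P_ ⇔ IsGorenstein (QuotLe q)
lemma5p16 n P _ _ (t , top) acyclic cc m q tree-quotient =
  (⇔-sym ConeQ.gorenstein⇔cutWeight ⇔-∘ mk⇔ cutWeight-pushforward cutWeight-lift)
    ⇔-∘ ConeP.gorenstein⇔cutWeight
  where
  open TreeQuotient P t top q tree-quotient
  open LiftedWeight P t top acyclic cc q tree-quotient
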